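{- For every integer $t \geq 2$, there exists a Latin square of order $n=t^2+t$ that contains a minimal $c$-cover for every $c \in \{t^2+t, t^2+t+1, \ldots, 3t^2\}$.
   Context: A Latin square of order $n$ is an $n\times n$ array on $n$ symbols in which each symbol occurs once in each row and each column; its entries are the triples $(i,j,L_{ij})$. A line is the set of all entries in a given row, in a given column, or with a given symbol. A cover is a set of entries meeting every line; a $c$-cover is a cover of size $c$. A cover $\mathscr{C}$ is minimal if for every entry $\mathbf{e}\in\mathscr{C}$ the set $\mathscr{C}\setminus\{\mathbf{e}\}$ is not a cover. -}

module Defs where

open import Data.Nat using (ℕ)
open import Data.Fin using (Fin)
open import Data.Product using (_×_; _,_; ∃; ∃-syntax; proj₁; proj₂)
open import Data.List using (List; length; filter)
open import Data.List.Membership.Propositional using (_∈_)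
open import Data.List.Relation.Unary.Any using (Any)
open import Data.List.Relation.Unary.Unique.Propositional using (Unique)
open import Relation.Binary.PropositionalEquality using (_≡_)
open import Relation.Nullary using (¬_)

record LatinSquare (n : ℕ) : Set where
  field
    L : Fin n → Fin n → Fin n
    rowOnce : ∀ i s → ∃[ j ] (L i j ≡ s × (∀ j' → L i j' ≡ s → j' ≡ j))
    colOnce : ∀ j s → ∃[ i ] (L i j ≡ s × (∀ i' → L i' j ≡ s → i' ≡ i))
open LatinSquare public

-- An entry (i , j , L i j) is determined by its cell (i , j).
Cell : ℕ → Set
Cell n = Fin n × Fin n

data Line (n : ℕ) : Set where
  row col sym : Fin n → Line n

OnLine : ∀ {n} → LatinSquare n → Cell n → Line n → Set
OnLine S (i , j) (row r) = i ≡ r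
OnLine S (i , j) (col c) = j ≡ c
OnLine S (i , j) (sym s) = L S i j ≡ s

IsCover : ∀ {n} → LatinSquare n → List (Cell n) → Set
IsCover S C = ∀ ℓ → Any (λ e → OnLine S e ℓ) C

_without_ : ∀ {n} → List (Cell n) → Cell n → List (Cell n)
C without e = filterNot C
  where
  open import Data.Fin.Properties using (_≟_)
  open import Data.Product.Properties using (≡-dec)
  open import Relation.Nullary.Decidable using (¬?)
  filterNot : List (Cell _) → List (Cell _)
  filterNot = filter (λ x → ¬? (≡-dec _≟_ _≟_ x e))

IsMinimalCover : ∀ {n} → LatinSquare n → List (Cell n) → Set
IsMinimalCover S C = Unique C × IsCover S C × (∀ e → e ∈ C → ¬ IsCover S (C without e))

HasMinimalCover : ∀ {n} → LatinSquare n → ℕ → Set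
HasMinimalCover S c = ∃[ C ] (IsMinimalCover S C × length C ≡ c)

-- For t = 2 an explicit square of order 6 and seven covers are checked by
-- computation (OrderSix).  For t = m ≥ 3 the square lives on
-- I = (ℤ/m)² ⊎ ℤ/m (Construction): a "grid" part built from addition in ℤ/m
-- and a corner Latin square of order m that has a transversal (CornerSquares).
-- The square has a transversal T; declaring 3m lines "shared", every unshared
-- line ℓ contains a solo entry meeting no other unshared line.  Replacing the
-- cell of T in some rows by the solo entries through it gives covers in which
-- every entry has a private line, hence minimal covers (TransversalCovers);
-- a row whose T-cell lies on d unshared lines adds d - 1 entries.  Double
-- counting the incidences between T and the lines shows that replacing all
-- rows gives 3m² entries, and choosing the replaced rows suitably, together
-- with one ad hoc cover of size n + 1, realises every size in between
-- (SizeRange).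
module Submission where

module IntegersModulo where

  open import Data.Nat as ℕ using (ℕ; suc)
  import Data.Nat.Properties as ℕP
  open import Data.Nat.DivMod using (_mod_; _%_; m%n<n; %-distribˡ-+; m%n%n≡m%n; m<n⇒m%n≡m; m*n%n≡0)
  open import Data.Fin using (Fin; toℕ)
  open import Data.Fin.Properties using (toℕ-fromℕ<; toℕ-injective; toℕ<n)
  open import Relation.Binary.PropositionalEquality
  open import Algebra.Structures using (IsAbelianGroup)
  open import Data.Product using (_,_)

  module ZMod (k : ℕ) where
    m : ℕ
    m = suc k

    Z : Set
    Z = Fin m

    reduce : ℕ → Z
    reduce x = x mod m

    toℕ-reduce : ∀ x → toℕ (reduce x) ≡ x % m
    toℕ-reduce x = toℕ-fromℕ< (m%n<n x m)

    reduce-cong : ∀ x y → x % m ≡ y % m → reduce x ≡ reduce y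
    reduce-cong x y e = toℕ-injective (trans (toℕ-reduce x) (trans e (sym (toℕ-reduce y))))

    reduce-toℕ : ∀ a → reduce (toℕ a) ≡ a
    reduce-toℕ a = toℕ-injective (trans (toℕ-reduce (toℕ a)) (m<n⇒m%n≡m (toℕ<n a)))

    reduce-+ˡ : ∀ x y → reduce (toℕ (reduce x) ℕ.+ y) ≡ reduce (x ℕ.+ y)
    reduce-+ˡ x y = reduce-cong (toℕ (reduce x) ℕ.+ y) (x ℕ.+ y) (begin
        (toℕ (reduce x) ℕ.+ y) % m     ≡⟨ cong (λ u → (u ℕ.+ y) % m) (toℕ-reduce x) ⟩
        (x % m ℕ.+ y) % m              ≡⟨ %-distribˡ-+ (x % m) y m ⟩
        (x % m % m ℕ.+ y % m) % m      ≡⟨ cong (λ u → (u ℕ.+ y % m) % m) (m%n%n≡m%n x m) ⟩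
        (x % m ℕ.+ y % m) % m          ≡⟨ sym (%-distribˡ-+ x y m) ⟩
        (x ℕ.+ y) % m                  ∎)
      where open ≡-Reasoning

    reduce-+ʳ : ∀ x y → reduce (x ℕ.+ toℕ (reduce y)) ≡ reduce (x ℕ.+ y)
    reduce-+ʳ x y = trans (cong reduce (ℕP.+-comm x _)) (trans (reduce-+ˡ y x) (cong reduce (ℕP.+-comm y x)))

    infixl 6 _+_
    infix 8 -_
    _+_ : Z → Z → Z
    a + b = reduce (toℕ a ℕ.+ toℕ b)

    -- - a is represented by k·a, since (k + 1)·a ≡ 0 (mod m).
    -_ : Z → Z
    - a = reduce (k ℕ.* toℕ a)

    0# 1# : Z
    0# = reduce 0
    1# = reduce 1

    +-assoc : ∀ a b c → (a + b) + c ≡ a + (b + c)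
    +-assoc a b c = trans (reduce-+ˡ (toℕ a ℕ.+ toℕ b) (toℕ c))
      (trans (cong reduce (ℕP.+-assoc (toℕ a) (toℕ b) (toℕ c))) (sym (reduce-+ʳ (toℕ a) (toℕ b ℕ.+ toℕ c))))

    +-comm : ∀ a b → a + b ≡ b + a
    +-comm a b = cong reduce (ℕP.+-comm (toℕ a) (toℕ b))

    +-identityˡ : ∀ a → 0# + a ≡ a
    +-identityˡ a = trans (reduce-+ˡ 0 (toℕ a)) (reduce-toℕ a)

    +-identityʳ : ∀ a → a + 0# ≡ a
    +-identityʳ a = trans (+-comm a 0#) (+-identityˡ a)

    -‿inverseˡ : ∀ a → (- a) + a ≡ 0#
    -‿inverseˡ a = trans (reduce-+ˡ (k ℕ.* toℕ a) (toℕ a)) (reduce-cong (k ℕ.* toℕ a ℕ.+ toℕ a) 0 (begin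
        (k ℕ.* toℕ a ℕ.+ toℕ a) % m ≡⟨ cong (_% m) (ℕP.+-comm (k ℕ.* toℕ a) (toℕ a)) ⟩
        (m ℕ.* toℕ a) % m           ≡⟨ cong (_% m) (ℕP.*-comm m (toℕ a)) ⟩
        (toℕ a ℕ.* m) % m           ≡⟨ m*n%n≡0 (toℕ a) m ⟩
        0 % m                       ∎))
      where open ≡-Reasoning

    -‿inverseʳ : ∀ a → a + (- a) ≡ 0#
    -‿inverseʳ a = trans (+-comm a (- a)) (-‿inverseˡ a)

    +-isAbelianGroup : IsAbelianGroup _≡_ _+_ 0# -_
    +-isAbelianGroup = record
      { isGroup = record
        { isMonoid = record
          { isSemigroup = record
            { isMagma = record { isEquivalence = isEquivalence ; ∙-cong = cong₂ _+_ }
            ; assoc = +-assoc }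
          ; identity = +-identityˡ , +-identityʳ }
        ; inverse = -‿inverseˡ , -‿inverseʳ
        ; ⁻¹-cong = cong -_ }
      ; comm = +-comm }


-- Expressions built from variables, 0, + and - are evaluated
-- to a pair of coefficient vectors (positive part, negative part); after
-- cancelling coefficientwise, equal group words have identical normal forms.
-- Unlike a ring solver it never inspects constants of the group, so it works
-- for ℤ/mℤ with a symbolic modulus m.
module AbelianGroupSolver where

  open import Data.Nat as ℕ using (ℕ; zero; suc; _∸_)
  open import Data.Fin using (Fin; zero; suc)
  open import Data.Vec using (Vec; []; _∷_; lookup; replicate; zipWith)
  open import Data.Product using (_×_; _,_; proj₁; proj₂)
  open import Relation.Binary.PropositionalEquality
  open import Algebra.Bundles using (AbelianGroup)
  open import Algebra.Structures using (IsAbelianGroup)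
  import Relation.Binary.Reflection as Reflection
  import Algebra.Properties.CommutativeMonoid.Mult as Multiples
  import Algebra.Properties.AbelianGroup as AbelianGroupProperties
  import Algebra.Properties.Group as GroupProperties
  import Algebra.Properties.CommutativeSemigroup as CommutativeSemigroupProperties

  module Solver {A : Set} {plus : A → A → A} {0# : A} {neg : A → A}
                (isAbelianGroup : IsAbelianGroup _≡_ plus 0# neg) where

    infixl 6 _+_ _-_
    infix 8 -_
    _+_ : A → A → A
    _+_ = plus
    -_ : A → A
    -_ = neg

    abelianGroup : AbelianGroup _ _
    abelianGroup = record { isAbelianGroup = isAbelianGroup }

    open AbelianGroup abelianGroup
      using (comm; identityˡ; identityʳ; inverseʳ; group; commutativeSemigroup; commutativeMonoid)
    open AbelianGroupProperties abelianGroup public using (⁻¹-∙-comm)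
    open GroupProperties group public using (⁻¹-involutive; inverseʳ-unique; ε⁻¹≈ε)
    open CommutativeSemigroupProperties commutativeSemigroup public using (interchange)
    open Multiples commutativeMonoid public using (×-homo-+; ×-distrib-+) renaming (_×_ to _·_)

    _-_ : A → A → A
    a - b = a + (- b)

    NormalForm : ℕ → Set
    NormalForm n = Vec ℕ n × Vec ℕ n

    evalCoeffs : ∀ {n} → Vec ℕ n → Vec A n → A
    evalCoeffs [] [] = 0#
    evalCoeffs (c ∷ cs) (x ∷ ρ) = (c · x) + evalCoeffs cs ρ

    evalNF : ∀ {n} → NormalForm n → Vec A n → A
    evalNF (p , q) ρ = evalCoeffs p ρ - evalCoeffs q ρ

    evalCoeffs-+ : ∀ {n} (p q : Vec ℕ n) ρ →
                   evalCoeffs (zipWith ℕ._+_ p q) ρ ≡ evalCoeffs p ρ + evalCoeffs q ρ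
    evalCoeffs-+ [] [] [] = sym (identityˡ 0#)
    evalCoeffs-+ (c ∷ p) (d ∷ q) (x ∷ ρ) =
      trans (cong₂ _+_ (×-homo-+ x c d) (evalCoeffs-+ p q ρ))
            (interchange (c · x) (d · x) (evalCoeffs p ρ) (evalCoeffs q ρ))

    zeros : ∀ n → Vec ℕ n
    zeros n = replicate n 0

    unit : ∀ {n} → Fin n → Vec ℕ n
    unit {suc n} zero = 1 ∷ zeros n
    unit {suc n} (suc i) = 0 ∷ unit i

    evalCoeffs-zeros : ∀ {n} (ρ : Vec A n) → evalCoeffs (zeros n) ρ ≡ 0#
    evalCoeffs-zeros [] = refl
    evalCoeffs-zeros (x ∷ ρ) = trans (identityˡ _) (evalCoeffs-zeros ρ)

    evalCoeffs-unit : ∀ {n} (i : Fin n) ρ → evalCoeffs (unit i) ρ ≡ lookup ρ i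
    evalCoeffs-unit zero (x ∷ ρ) = trans (cong₂ _+_ (identityʳ x) (evalCoeffs-zeros ρ)) (identityʳ x)
    evalCoeffs-unit (suc i) (x ∷ ρ) = trans (identityˡ _) (evalCoeffs-unit i ρ)

    infixl 6 _:+_
    infix 8 :-_
    data Expr (n : ℕ) : Set where
      var : Fin n → Expr n
      :0 : Expr n
      _:+_ : Expr n → Expr n → Expr n
      :-_ : Expr n → Expr n

    ⟦_⟧ : ∀ {n} → Expr n → Vec A n → A
    ⟦ var i ⟧ ρ = lookup ρ i
    ⟦ :0 ⟧ ρ = 0#
    ⟦ e :+ f ⟧ ρ = ⟦ e ⟧ ρ + ⟦ f ⟧ ρ
    ⟦ :- e ⟧ ρ = - ⟦ e ⟧ ρ

    normalise : ∀ {n} → Expr n → NormalForm n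
    normalise {n} (var i) = unit i , zeros n
    normalise {n} :0 = zeros n , zeros n
    normalise (e :+ f) = zipWith ℕ._+_ (proj₁ (normalise e)) (proj₁ (normalise f)) ,
                         zipWith ℕ._+_ (proj₂ (normalise e)) (proj₂ (normalise f))
    normalise (:- e) = proj₂ (normalise e) , proj₁ (normalise e)

    cancel : ∀ {n} → NormalForm n → NormalForm n
    cancel (p , q) = zipWith _∸_ p q , zipWith _∸_ q p

    ⟦_⇓⟧ : ∀ {n} → Expr n → Vec A n → A
    ⟦ e ⇓⟧ ρ = evalNF (cancel (normalise e)) ρ

    -‿+-interchange : ∀ a b c d → (a - b) + (c - d) ≡ (a + c) - (b + d)
    -‿+-interchange a b c d = trans (interchange a (- b) c (- d)) (cong ((a + c) +_) (⁻¹-∙-comm b d))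

    normalise-correct : ∀ {n} (e : Expr n) ρ → evalNF (normalise e) ρ ≡ ⟦ e ⟧ ρ
    normalise-correct (var i) ρ =
      trans (cong₂ _-_ (evalCoeffs-unit i ρ) (evalCoeffs-zeros ρ)) (trans (cong (lookup ρ i +_) ε⁻¹≈ε) (identityʳ _))
    normalise-correct :0 ρ = trans (cong₂ _-_ (evalCoeffs-zeros ρ) (evalCoeffs-zeros ρ)) (inverseʳ 0#)
    normalise-correct (e :+ f) ρ =
      trans (cong₂ _-_ (evalCoeffs-+ (proj₁ (normalise e)) (proj₁ (normalise f)) ρ)
                       (evalCoeffs-+ (proj₂ (normalise e)) (proj₂ (normalise f)) ρ))
            (trans (sym (-‿+-interchange _ _ _ _)) (cong₂ _+_ (normalise-correct e ρ) (normalise-correct f ρ)))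
    normalise-correct (:- e) ρ = begin
        evalCoeffs q ρ - evalCoeffs p ρ         ≡⟨ comm _ _ ⟩
        (- evalCoeffs p ρ) + evalCoeffs q ρ     ≡⟨ cong ((- evalCoeffs p ρ) +_) (sym (⁻¹-involutive _)) ⟩
        (- evalCoeffs p ρ) + - (- evalCoeffs q ρ) ≡⟨ ⁻¹-∙-comm _ _ ⟩
        (- evalNF (p , q) ρ)                    ≡⟨ cong -_ (normalise-correct e ρ) ⟩
        (- ⟦ e ⟧ ρ)                             ∎
      where
      open ≡-Reasoning
      p = proj₁ (normalise e)
      q = proj₂ (normalise e)

    cancel-one : ∀ c d x → (c · x) - (d · x) ≡ ((c ∸ d) · x) - ((d ∸ c) · x)
    cancel-one zero zero x = refl
    cancel-one zero (suc d) x = refl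
    cancel-one (suc c) zero x = refl
    cancel-one (suc c) (suc d) x = trans drop-x (cancel-one c d x)
      where
      open ≡-Reasoning
      drop-x : (x + (c · x)) - (x + (d · x)) ≡ (c · x) - (d · x)
      drop-x = begin
        (x + (c · x)) - (x + (d · x))  ≡⟨ sym (-‿+-interchange x x (c · x) (d · x)) ⟩
        (x - x) + ((c · x) - (d · x))  ≡⟨ cong (_+ ((c · x) - (d · x))) (inverseʳ x) ⟩
        0# + ((c · x) - (d · x))       ≡⟨ identityˡ _ ⟩
        (c · x) - (d · x)              ∎

    cancel-correct : ∀ {n} (nf : NormalForm n) ρ → evalNF (cancel nf) ρ ≡ evalNF nf ρ
    cancel-correct ([] , []) [] = refl
    cancel-correct (c ∷ p , d ∷ q) (x ∷ ρ) = begin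
        ((c ∸ d) · x + evalCoeffs (zipWith _∸_ p q) ρ) - ((d ∸ c) · x + evalCoeffs (zipWith _∸_ q p) ρ)
          ≡⟨ sym (-‿+-interchange _ _ _ _) ⟩
        ((c ∸ d) · x - (d ∸ c) · x) + evalNF (cancel (p , q)) ρ
          ≡⟨ cong₂ _+_ (sym (cancel-one c d x)) (cancel-correct (p , q) ρ) ⟩
        ((c · x) - (d · x)) + (evalCoeffs p ρ - evalCoeffs q ρ)
          ≡⟨ -‿+-interchange _ _ _ _ ⟩
        (c · x + evalCoeffs p ρ) - (d · x + evalCoeffs q ρ) ∎
      where open ≡-Reasoning

    correct : ∀ {n} (e : Expr n) ρ → ⟦ e ⇓⟧ ρ ≡ ⟦ e ⟧ ρ
    correct e ρ = trans (cancel-correct (normalise e) ρ) (normalise-correct e ρ)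

    open Reflection (setoid A) var ⟦_⟧ ⟦_⇓⟧ correct public using (solve)

    infix 4 _⊜_
    _⊜_ : ∀ {n} → Expr n → Expr n → Expr n × Expr n
    _⊜_ = _,_



module ListFacts where

  open import Data.Nat as ℕ using (ℕ; zero; suc; _+_; _*_)
  import Data.Nat.Properties as ℕP
  open import Data.List using (List; []; _∷_; _++_; map; length; take; filter)
  open import Data.List.Properties using (length-++)
  open import Data.List.Relation.Unary.Any using (here; there)
  import Data.List.Relation.Unary.All as All
  open import Data.List.Relation.Unary.AllPairs using ([]; _∷_)
  open import Data.List.Relation.Unary.Unique.Propositional using (Unique)
  import Data.List.Relation.Unary.Unique.Propositional.Properties as Unique
  open import Data.List.Membership.Propositional using (_∈_; _∉_)
  open import Data.List.Membership.Propositional.Properties using (∈-++⁺ˡ; ∈-++⁺ʳ; ∈-++⁻; ∈-map⁻)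
  open import Data.Product using (Σ; _×_; _,_)
  open import Data.Sum using (inj₁; inj₂)
  open import Data.Empty using (⊥-elim)
  open import Data.Bool using (Bool; true; false; _∨_)
  open import Relation.Nullary using (¬_; Dec; yes; no; does)
  open import Relation.Nullary.Decidable using (¬?)
  open import Relation.Binary.PropositionalEquality
  open import Relation.Binary.Definitions using (DecidableEquality)
  open import Algebra.Properties.CommutativeSemigroup ℕP.+-commutativeSemigroup using (interchange)

  unique-map-on : ∀ {A B : Set} (f : A → B) xs → (∀ {x y} → x ∈ xs → y ∈ xs → f x ≡ f y → x ≡ y) →
                  Unique xs → Unique (map f xs)
  unique-map-on f [] inj u = []
  unique-map-on f (x ∷ xs) inj (x∉ ∷ u) =
    All.tabulate fresh ∷ unique-map-on f xs (λ mx my e → inj (there mx) (there my) e) u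
    where
    fresh : ∀ {z} → z ∈ map f xs → f x ≢ z
    fresh m e with ∈-map⁻ f m
    ... | y , ym , refl = All.lookup x∉ ym (inj (here refl) (there ym) e)

  module _ {A B : Set} where
    cmap : (A → List B) → List A → List B
    cmap f [] = []
    cmap f (x ∷ xs) = f x ++ cmap f xs

    ∈-cmap⁻ : ∀ (f : A → List B) xs {b} → b ∈ cmap f xs → Σ A λ x → x ∈ xs × b ∈ f x
    ∈-cmap⁻ f (x ∷ xs) m with ∈-++⁻ (f x) m
    ... | inj₁ m' = x , here refl , m'
    ... | inj₂ m' with ∈-cmap⁻ f xs m'
    ... | y , yi , bi = y , there yi , bi

    ∈-cmap⁺ : ∀ (f : A → List B) {xs x b} → x ∈ xs → b ∈ f x → b ∈ cmap f xs
    ∈-cmap⁺ f {x' ∷ xs} (here refl) bi = ∈-++⁺ˡ bi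
    ∈-cmap⁺ f {x' ∷ xs} (there xi) bi = ∈-++⁺ʳ (f x') (∈-cmap⁺ f xi bi)

    unique-cmap : ∀ (f : A → List B) xs → Unique xs → (∀ x → Unique (f x)) →
                  (∀ x y {b} → b ∈ f x → b ∈ f y → x ≡ y) → Unique (cmap f xs)
    unique-cmap f [] _ _ _ = []
    unique-cmap f (x ∷ xs) (x∉ ∷ u) uf disj = Unique.++⁺ (uf x) (unique-cmap f xs u uf disj) disjoint
      where
      disjoint : ∀ {v} → ¬ (v ∈ f x × v ∈ cmap f xs)
      disjoint (v1 , v2) with ∈-cmap⁻ f xs v2
      ... | y , yi , bi = All.lookup x∉ yi (disj x y v1 bi)

  ΣL : ∀ {A : Set} → (A → ℕ) → List A → ℕ
  ΣL f [] = 0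
  ΣL f (x ∷ xs) = f x + ΣL f xs

  length-cmap : ∀ {A B : Set} (f : A → List B) xs → length (cmap f xs) ≡ ΣL (λ x → length (f x)) xs
  length-cmap f [] = refl
  length-cmap f (x ∷ xs) = trans (length-++ (f x)) (cong (length (f x) +_) (length-cmap f xs))

  ΣL-cong : ∀ {A : Set} {f g : A → ℕ} xs → (∀ x → x ∈ xs → f x ≡ g x) → ΣL f xs ≡ ΣL g xs
  ΣL-cong [] h = refl
  ΣL-cong (x ∷ xs) h = cong₂ _+_ (h x (here refl)) (ΣL-cong xs (λ y m → h y (there m)))

  ΣL-+ : ∀ {A : Set} (f g : A → ℕ) xs → ΣL (λ x → f x + g x) xs ≡ ΣL f xs + ΣL g xs
  ΣL-+ f g [] = refl
  ΣL-+ f g (x ∷ xs) = trans (cong (f x + g x +_) (ΣL-+ f g xs)) (interchange (f x) (g x) (ΣL f xs) (ΣL g xs))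

  ΣL-* : ∀ {A : Set} (k : ℕ) (f : A → ℕ) xs → ΣL (λ x → k * f x) xs ≡ k * ΣL f xs
  ΣL-* k f [] = sym (ℕP.*-zeroʳ k)
  ΣL-* k f (x ∷ xs) = trans (cong (k * f x +_) (ΣL-* k f xs)) (sym (ℕP.*-distribˡ-+ k (f x) _))

  ΣL-1 : ∀ {A : Set} (xs : List A) → ΣL (λ _ → 1) xs ≡ length xs
  ΣL-1 [] = refl
  ΣL-1 (x ∷ xs) = cong suc (ΣL-1 xs)

  ind : Bool → ℕ
  ind true = 1
  ind false = 0

  module Indicators {A : Set} (_≟_ : DecidableEquality A) where
    eqb : A → A → ℕ
    eqb x y = ind (does (x ≟ y))

    memb : A → List A → Bool
    memb x [] = false
    memb x (y ∷ ys) = does (x ≟ y) ∨ memb x ys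

    memb-true : ∀ {x ys} → memb x ys ≡ true → x ∈ ys
    memb-true {x} {y ∷ ys} e with x ≟ y
    ... | yes refl = here refl
    ... | no _ = there (memb-true e)

    memb-∈ : ∀ {x ys} → x ∈ ys → memb x ys ≡ true
    memb-∈ {x} {y ∷ ys} (here refl) with x ≟ x
    ... | yes _ = refl
    ... | no ne = ⊥-elim (ne refl)
    memb-∈ {x} {y ∷ ys} (there m) with x ≟ y
    ... | yes _ = refl
    ... | no _ = memb-∈ m

    memb-false : ∀ {x ys} → memb x ys ≡ false → x ∉ ys
    memb-false e m with trans (sym e) (memb-∈ m)
    ... | ()

    ΣL-eqb-∉ : ∀ y xs → y ∉ xs → ΣL (λ x → eqb x y) xs ≡ 0
    ΣL-eqb-∉ y [] _ = refl
    ΣL-eqb-∉ y (x ∷ xs) ni with x ≟ y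
    ... | yes refl = ⊥-elim (ni (here refl))
    ... | no _ = ΣL-eqb-∉ y xs (λ m → ni (there m))

    ΣL-eqb-∈ : ∀ y xs → Unique xs → y ∈ xs → ΣL (λ x → eqb x y) xs ≡ 1
    ΣL-eqb-∈ y (x ∷ xs) (x∉ ∷ u) m with x ≟ y
    ... | yes refl = cong suc (ΣL-eqb-∉ y xs (λ m' → All.lookup x∉ m' refl))
    ΣL-eqb-∈ y (x ∷ xs) (x∉ ∷ u) (here refl) | no ne = ⊥-elim (ne refl)
    ΣL-eqb-∈ y (x ∷ xs) (x∉ ∷ u) (there m) | no ne = ΣL-eqb-∈ y xs u m

    indm : List A → A → ℕ
    indm F x = ind (memb x F)

    indm-∷ : ∀ y F x → y ∉ F → indm (y ∷ F) x ≡ eqb x y + indm F x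
    indm-∷ y F x y∉ with x ≟ y
    ... | no _ = refl
    ... | yes refl with memb x F in e
    ... | false = refl
    ... | true = ⊥-elim (y∉ (memb-true e))

    ΣL-indm-[] : ∀ xs → ΣL (indm []) xs ≡ 0
    ΣL-indm-[] [] = refl
    ΣL-indm-[] (_ ∷ xs) = ΣL-indm-[] xs

    count-sublist : ∀ (U F : List A) → Unique U → Unique F → (∀ x → x ∈ F → x ∈ U) →
                    ΣL (indm F) U ≡ length F
    count-sublist U [] uU uF sub = ΣL-indm-[] U
    count-sublist U (y ∷ F) uU (y∉ ∷ uF) sub = begin
        ΣL (indm (y ∷ F)) U                   ≡⟨ ΣL-cong U (λ x _ → indm-∷ y F x (λ m → All.lookup y∉ m refl)) ⟩
        ΣL (λ x → eqb x y + indm F x) U       ≡⟨ ΣL-+ (λ x → eqb x y) (indm F) U ⟩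
        ΣL (λ x → eqb x y) U + ΣL (indm F) U  ≡⟨ cong₂ _+_ (ΣL-eqb-∈ y U uU (sub y (here refl)))
                                                           (count-sublist U F uU uF (λ x m → sub x (there m))) ⟩
        suc (length F)                        ∎
      where open ≡-Reasoning

    ind≡indm : ∀ (b : Bool) (S : List A) r → (b ≡ true → r ∈ S) → (r ∈ S → b ≡ true) → ind b ≡ indm S r
    ind≡indm true S r to fro with memb r S in em
    ... | true = refl
    ... | false = ⊥-elim (memb-false em (to refl))
    ind≡indm false S r to fro with memb r S in em
    ... | false = refl
    ... | true with fro (memb-true em)
    ... | ()

    without : A → List A → List A
    without x = filter (λ y → ¬? (y ≟ x))

    length-without-∉ : ∀ x xs → x ∉ xs → length (without x xs) ≡ length xs
    length-without-∉ x [] _ = refl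
    length-without-∉ x (y ∷ xs) ni with y ≟ x
    ... | yes refl = ⊥-elim (ni (here refl))
    ... | no _ = cong suc (length-without-∉ x xs (λ m → ni (there m)))

    length-without-∈ : ∀ x xs → Unique xs → x ∈ xs → suc (length (without x xs)) ≡ length xs
    length-without-∈ x (y ∷ xs) (y∉ ∷ u) m with y ≟ x
    ... | yes refl = cong suc (length-without-∉ x xs (λ m' → All.lookup y∉ m' refl))
    length-without-∈ x (y ∷ xs) (y∉ ∷ u) (here e) | no ne = ⊥-elim (ne (sym e))
    length-without-∈ x (y ∷ xs) (y∉ ∷ u) (there m) | no ne = cong suc (length-without-∈ x xs u m)

  module _ {A : Set} where
    take-⊆ : ∀ j (xs : List A) {x} → x ∈ take j xs → x ∈ xs
    take-⊆ zero xs ()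
    take-⊆ (suc j) (y ∷ xs) (here e) = here e
    take-⊆ (suc j) (y ∷ xs) (there m) = there (take-⊆ j xs m)

    length-take-≤ : ∀ j (xs : List A) → j ℕ.≤ length xs → length (take j xs) ≡ j
    length-take-≤ zero xs _ = refl
    length-take-≤ (suc j) (y ∷ xs) (ℕ.s≤s le) = cong suc (length-take-≤ j xs le)

  count-filter : ∀ {A : Set} {P : A → Set} (P? : ∀ x → Dec (P x)) xs →
                 ΣL (λ r → ind (does (P? r))) xs ≡ length (filter P? xs)
  count-filter P? [] = refl
  count-filter P? (x ∷ xs) with does (P? x)
  ... | true = cong suc (count-filter P? xs)
  ... | false = count-filter P? xs


-- Every line is declared shared or unshared; each unshared
-- line ℓ has a "solo" entry on ℓ that lies on no other unshared line.
-- Replacing, for a chosen set of rows r, the transversal cell of r by the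
-- solo entries of the unshared lines through it yields a cover in which every
-- entry has a private line (so the cover is minimal), of size
-- n + Σ (degree r - 1) over the replaced rows.
module TransversalCovers where

  open import Data.Nat as ℕ using (ℕ; suc; _+_; _*_)
  open import Data.List using (List; []; _∷_; map; length; filter)
  import Data.Nat.Properties as ℕP
  open import Data.List.Properties using (length-map; length-filter; filter-notAll)
  open import Data.List.Relation.Unary.Any using (Any; here; there)
  open import Data.List.Relation.Unary.All using ([]; _∷_)
  import Data.List.Relation.Unary.All as All
  open import Data.List.Relation.Unary.AllPairs using ([]; _∷_)
  open import Data.List.Relation.Unary.Unique.Propositional using (Unique)
  import Data.List.Relation.Unary.Unique.Propositional.Properties as Unique
  open import Data.List.Membership.Propositional using (_∈_; lose)
  open import Data.List.Membership.Propositional.Properties using (∈-map⁺; ∈-map⁻; ∈-filter⁺; ∈-filter⁻)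
  open import Data.Product using (Σ; _×_; _,_; proj₁; proj₂)
  open import Data.Sum using (_⊎_; inj₁; inj₂)
  open import Data.Empty using (⊥; ⊥-elim)
  open import Relation.Nullary using (¬_; Dec; yes; no; does)
  open import Relation.Binary.PropositionalEquality
  open import Data.Bool using (Bool; true; false; if_then_else_; not; _∨_)
  import Data.Bool.Properties as Bool
  open import Relation.Binary.Definitions using (DecidableEquality)
  open ListFacts

  data Ln (I : Set) : Set where
    rw cl sy : I → Ln I

  module Square {I : Set} (L : I → I → I) where
    Cell : Set
    Cell = I × I

    On : Cell → Ln I → Set
    On (r , c) (rw x) = r ≡ x
    On (r , c) (cl x) = c ≡ x
    On (r , c) (sy x) = L r c ≡ x

    PrivateLine : List Cell → Cell → Set
    PrivateLine C b = Σ (Ln I) λ ℓ → On b ℓ × (∀ b' → b' ∈ C → On b' ℓ → b' ≡ b)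

    -- A duplicate-free cover in which every entry has a private line, i.e. a minimal cover.
    record Certified (C : List Cell) : Set where
      field
        uniq : Unique C
        covers : ∀ ℓ → Any (λ b → On b ℓ) C
        privs : ∀ b → b ∈ C → PrivateLine C b

  module Frame {I : Set} (_≟_ : DecidableEquality I) (L : I → I → I)
    (allI : List I) (allI-u : Unique allI) (allI-c : ∀ x → x ∈ allI)
    (shared : Ln I → Bool) (solo : Ln I → I × I) (tcol : I → I) (owner : Ln I → I) where

    open Square L public

    tcell : I → Cell
    tcell r = r , tcol r

    tsym : I → I
    tsym r = L r (tcol r)

    Unshared : Ln I → Set
    Unshared ℓ = shared ℓ ≡ false

    record Hyp : Set where
      field
        solo-on : ∀ ℓ → Unshared ℓ → On (solo ℓ) ℓ
        solo-only : ∀ ℓ ℓ' → Unshared ℓ → Unshared ℓ' → On (solo ℓ) ℓ' → ℓ' ≡ ℓ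
        owner-on : ∀ ℓ → On (tcell (owner ℓ)) ℓ
        owner-unique : ∀ r ℓ → On (tcell r) ℓ → r ≡ owner ℓ
        unshared-line : ∀ r → Σ (Ln I) λ ℓ → Unshared ℓ × On (tcell r) ℓ

    degree : I → ℕ
    degree r = ind (not (shared (rw r))) + ind (not (shared (cl (tcol r)))) + ind (not (shared (sy (tsym r))))

    linesAt : I → List (Ln I)
    linesAt r = rw r ∷ cl (tcol r) ∷ sy (tsym r) ∷ []

    unshared? : ∀ ℓ → Dec (Unshared ℓ)
    unshared? ℓ = shared ℓ Bool.≟ false

    unsharedAt : I → List (Ln I)
    unsharedAt r = filter unshared? (linesAt r)

    length-filter-∷ : ∀ ℓ ls → length (filter unshared? (ℓ ∷ ls)) ≡ ind (not (shared ℓ)) + length (filter unshared? ls)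
    length-filter-∷ ℓ ls with shared ℓ
    ... | true = refl
    ... | false = refl

    length-unsharedAt : ∀ r → length (unsharedAt r) ≡ degree r
    length-unsharedAt r = begin
      length (filter unshared? (linesAt r))
        ≡⟨ length-filter-∷ (rw r) _ ⟩
      ind (not (shared (rw r))) + length (filter unshared? (cl (tcol r) ∷ sy (tsym r) ∷ []))
        ≡⟨ cong (ind (not (shared (rw r))) +_) (length-filter-∷ (cl (tcol r)) _) ⟩
      ind (not (shared (rw r))) + (ind (not (shared (cl (tcol r)))) + length (filter unshared? (sy (tsym r) ∷ [])))
        ≡⟨ cong (λ k → ind (not (shared (rw r))) + (ind (not (shared (cl (tcol r)))) + k)) (length-filter-∷ (sy (tsym r)) []) ⟩
      ind (not (shared (rw r))) + (ind (not (shared (cl (tcol r)))) + (ind (not (shared (sy (tsym r)))) + 0))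
        ≡⟨ reassociate (ind (not (shared (rw r)))) (ind (not (shared (cl (tcol r))))) (ind (not (shared (sy (tsym r))))) ⟩
      degree r ∎
      where
      open ≡-Reasoning
      reassociate : ∀ a b c → a + (b + (c + 0)) ≡ a + b + c
      reassociate a b c = trans (sym (ℕP.+-assoc a b (c + 0))) (cong (a + b +_) (ℕP.+-identityʳ c))

    linesAt-u : ∀ r → Unique (linesAt r)
    linesAt-u r = ((λ ()) ∷ (λ ()) ∷ []) ∷ ((λ ()) ∷ []) ∷ [] ∷ []

    linesAt-on : ∀ r {ℓ} → ℓ ∈ linesAt r → On (tcell r) ℓ
    linesAt-on r (here refl) = refl
    linesAt-on r (there (here refl)) = refl
    linesAt-on r (there (there (here refl))) = refl

    on-linesAt : ∀ r ℓ → On (tcell r) ℓ → ℓ ∈ linesAt r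
    on-linesAt r (rw x) refl = here refl
    on-linesAt r (cl x) refl = there (here refl)
    on-linesAt r (sy x) refl = there (there (here refl))

    unsharedAt-inv : ∀ r {ℓ} → ℓ ∈ unsharedAt r → Unshared ℓ × On (tcell r) ℓ
    unsharedAt-inv r m = let (a , b) = ∈-filter⁻ unshared? m in b , linesAt-on r a

    unsharedAt-in : ∀ r ℓ → Unshared ℓ → On (tcell r) ℓ → ℓ ∈ unsharedAt r
    unsharedAt-in r ℓ e o = ∈-filter⁺ unshared? (on-linesAt r ℓ o) e

    degree≤3 : ∀ r → degree r ℕ.≤ 3
    degree≤3 r = subst (ℕ._≤ 3) (length-unsharedAt r) (length-filter unshared? (linesAt r))

    degree-3⇒unshared : ∀ r ℓ → degree r ≡ 3 → On (tcell r) ℓ → Unshared ℓ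
    degree-3⇒unshared r ℓ e o with unshared? ℓ
    ... | yes u = u
    ... | no ¬u = ⊥-elim (ℕP.<-irrefl (trans (length-unsharedAt r) e)
                            (filter-notAll unshared? (linesAt r) (lose (on-linesAt r ℓ o) ¬u)))

    module WithHyp (H : Hyp) where
      open Hyp H

      solo-injective : ∀ {ℓ ℓ'} → Unshared ℓ → Unshared ℓ' → solo ℓ ≡ solo ℓ' → ℓ ≡ ℓ'
      solo-injective {ℓ} {ℓ'} e e' q = solo-only ℓ' ℓ e' e (subst (λ b → On b ℓ) q (solo-on ℓ e))

      solosAt : I → List Cell
      solosAt r = map solo (unsharedAt r)

      solosAt-u : ∀ r → Unique (solosAt r)
      solosAt-u r = unique-map-on solo (unsharedAt r)
        (λ mx my q → solo-injective (proj₁ (unsharedAt-inv r mx)) (proj₁ (unsharedAt-inv r my)) q)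
        (Unique.filter⁺ unshared? (linesAt-u r))

      module Cov (out : I → Bool) where
        piece : I → List Cell
        piece r = if out r then solosAt r else tcell r ∷ []

        cov : List Cell
        cov = cmap piece allI

        PieceInv : I → Cell → Set
        PieceInv r b = (out r ≡ false × b ≡ tcell r) ⊎
                       (out r ≡ true × Σ (Ln I) λ ℓ → Unshared ℓ × On (tcell r) ℓ × b ≡ solo ℓ)

        piece-inv : ∀ r {b} → b ∈ piece r → PieceInv r b
        piece-inv r {b} m with out r in e
        ... | false with m
        ... | here q = inj₁ (refl , q)
        piece-inv r {b} m | true with ∈-map⁻ solo m
        ... | ℓ , ℓm , q = inj₂ (refl , ℓ , proj₁ (unsharedAt-inv r ℓm) , proj₂ (unsharedAt-inv r ℓm) , q)

        mem-inv : ∀ {b} → b ∈ cov → Σ I λ r → PieceInv r b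
        mem-inv m with ∈-cmap⁻ piece allI m
        ... | r , _ , bm = r , piece-inv r bm

        disjoint : ∀ r r' {b} → b ∈ piece r → b ∈ piece r' → r ≡ r'
        disjoint r r' m m' with piece-inv r m | piece-inv r' m'
        ... | inj₁ (_ , q) | inj₁ (_ , q') = cong proj₁ (trans (sym q) q')
        ... | inj₁ (_ , q) | inj₂ (_ , ℓ , e , o , q') =
              trans (owner-unique r ℓ (subst (λ b → On b ℓ) (trans (sym q') q) (solo-on ℓ e))) (sym (owner-unique r' ℓ o))
        ... | inj₂ (_ , ℓ , e , o , q) | inj₁ (_ , q') =
              trans (owner-unique r ℓ o) (sym (owner-unique r' ℓ (subst (λ b → On b ℓ) (trans (sym q) q') (solo-on ℓ e))))
        ... | inj₂ (_ , ℓ , e , o , q) | inj₂ (_ , ℓ' , e' , o' , q') with solo-injective e e' (trans (sym q) q')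
        ... | refl = trans (owner-unique r ℓ o) (sym (owner-unique r' ℓ o'))

        piece-u : ∀ r → Unique (piece r)
        piece-u r with out r
        ... | true = solosAt-u r
        ... | false = [] ∷ []

        cov-u : Unique cov
        cov-u = unique-cmap piece allI allI-u piece-u disjoint

        mem-tcell : ∀ r → out r ≡ false → tcell r ∈ cov
        mem-tcell r e = ∈-cmap⁺ piece (allI-c r) in-piece
          where
          in-piece : tcell r ∈ piece r
          in-piece rewrite e = here refl

        mem-solo : ∀ r ℓ → out r ≡ true → Unshared ℓ → On (tcell r) ℓ → solo ℓ ∈ cov
        mem-solo r ℓ e s o = ∈-cmap⁺ piece (allI-c r) in-piece
          where
          in-piece : solo ℓ ∈ piece r
          in-piece rewrite e = ∈-map⁺ solo (unsharedAt-in r ℓ s o)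

        on-unshared : ∀ ℓ → Unshared ℓ → ∀ {b} → b ∈ cov → On b ℓ →
                      (out (owner ℓ) ≡ false × b ≡ tcell (owner ℓ)) ⊎ (out (owner ℓ) ≡ true × b ≡ solo ℓ)
        on-unshared ℓ s m on with mem-inv m
        ... | r , inj₁ (o , refl) rewrite owner-unique r ℓ on = inj₁ (o , refl)
        ... | r , inj₂ (o , ℓ' , s' , on' , refl) with solo-only ℓ' ℓ s' s on
        ... | refl rewrite owner-unique r ℓ on' = inj₂ (o , refl)

        privs : ∀ b → b ∈ cov → PrivateLine cov b
        privs b m with mem-inv m
        ... | r , inj₁ (o , refl) with unshared-line r
        ... | ℓ , s , on = ℓ , on , only-tcell
          where
          only-tcell : ∀ b' → b' ∈ cov → On b' ℓ → b' ≡ tcell r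
          only-tcell b' m' on' rewrite owner-unique r ℓ on with on-unshared ℓ s m' on'
          ... | inj₁ (_ , q) = q
          ... | inj₂ (o' , _) = ⊥-elim (Bool.not-¬ refl (trans (sym o) o'))
        privs b m | r , inj₂ (o , ℓ , s , on , refl) = ℓ , solo-on ℓ s , only-solo
          where
          only-solo : ∀ b' → b' ∈ cov → On b' ℓ → b' ≡ solo ℓ
          only-solo b' m' on' rewrite owner-unique r ℓ on with on-unshared ℓ s m' on'
          ... | inj₁ (o' , _) = ⊥-elim (Bool.not-¬ refl (trans (sym o') o))
          ... | inj₂ (_ , q) = q

        covers-unshared : ∀ ℓ → Unshared ℓ → Any (λ b → On b ℓ) cov
        covers-unshared ℓ s with out (owner ℓ) in e
        ... | false = lose (mem-tcell (owner ℓ) e) (owner-on ℓ)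
        ... | true = lose (mem-solo (owner ℓ) ℓ e s (owner-on ℓ)) (solo-on ℓ s)

        SharedOK : Ln I → Set
        SharedOK ℓ = (out (owner ℓ) ≡ false) ⊎
                     (Σ (Ln I) λ ℓ' → Unshared ℓ' × On (solo ℓ') ℓ × out (owner ℓ') ≡ true)

        covers-shared : ∀ ℓ → SharedOK ℓ → Any (λ b → On b ℓ) cov
        covers-shared ℓ (inj₁ e) = lose (mem-tcell (owner ℓ) e) (owner-on ℓ)
        covers-shared ℓ (inj₂ (ℓ' , s' , on , e)) = lose (mem-solo (owner ℓ') ℓ' e s' (owner-on ℓ')) on

        certified : (∀ ℓ → shared ℓ ≡ true → SharedOK ℓ) → Certified cov
        certified sok = record { uniq = cov-u ; covers = covers ; privs = privs }
          where
          covers : ∀ ℓ → Any (λ b → On b ℓ) cov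
          covers ℓ with shared ℓ in e
          ... | true = covers-shared ℓ (sok ℓ e)
          ... | false = covers-unshared ℓ e

        length-cov : length cov ≡ ΣL (λ r → if out r then degree r else 1) allI
        length-cov = trans (length-cmap piece allI) (ΣL-cong allI (λ r _ → length-piece r))
          where
          length-piece : ∀ r → length (piece r) ≡ (if out r then degree r else 1)
          length-piece r with out r
          ... | true = trans (length-map solo (unsharedAt r)) (length-unsharedAt r)
          ... | false = refl

      degree≥1 : ∀ r → 1 ℕ.≤ degree r
      degree≥1 r with unshared-line r
      ... | ℓ , s , o = subst (1 ℕ.≤_) (length-unsharedAt r) (nonempty (unsharedAt-in r ℓ s o))
        where
        nonempty : ∀ {xs : List (Ln I)} → ℓ ∈ xs → 1 ℕ.≤ length xs
        nonempty (here _) = ℕ.s≤s ℕ.z≤n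
        nonempty (there _) = ℕ.s≤s ℕ.z≤n

      open Indicators _≟_ using (memb; memb-true; memb-∈; indm; count-sublist; ind≡indm)

      -- Replace the rows of Fl (degree 2) and Kl (degree 3): the cover has
      -- n + |Fl| + 2|Kl| entries, and it is certified provided every shared
      -- line owned by a row of Fl passes through a solo entry of a row of Kl
      -- (shared lines owned by rows of Kl do not exist).
      module Replacing (Fl Kl : List I) (uF : Unique Fl) (uK : Unique Kl)
                 (pF : ∀ r → r ∈ Fl → degree r ≡ 2) (pK : ∀ r → r ∈ Kl → degree r ≡ 3) where
        out : I → Bool
        out r = memb r Fl ∨ memb r Kl

        open Cov out public

        length-replace : length cov ≡ length allI + length Fl + 2 * length Kl
        length-replace = begin
            length cov ≡⟨ length-cov ⟩
            ΣL (λ r → if out r then degree r else 1) allI ≡⟨ ΣL-cong allI (λ r _ → pw r) ⟩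
            ΣL (λ r → (1 + indm Fl r) + 2 * indm Kl r) allI ≡⟨ ΣL-+ (λ r → 1 + indm Fl r) (λ r → 2 * indm Kl r) allI ⟩
            ΣL (λ r → 1 + indm Fl r) allI + ΣL (λ r → 2 * indm Kl r) allI
              ≡⟨ cong₂ _+_ (ΣL-+ (λ _ → 1) (indm Fl) allI) (ΣL-* 2 (indm Kl) allI) ⟩
            (ΣL (λ _ → 1) allI + ΣL (indm Fl) allI) + 2 * ΣL (indm Kl) allI
              ≡⟨ cong₂ (λ a b → a + b) (cong₂ _+_ (ΣL-1 allI) (count-sublist allI Fl allI-u uF (λ x _ → allI-c x)))
                       (cong (2 *_) (count-sublist allI Kl allI-u uK (λ x _ → allI-c x))) ⟩
            length allI + length Fl + 2 * length Kl ∎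
          where
          open ≡-Reasoning
          pw : ∀ r → (if out r then degree r else 1) ≡ (1 + indm Fl r) + 2 * indm Kl r
          pw r with memb r Fl in eF | memb r Kl in eK
          ... | true | true with trans (sym (pF r (memb-true eF))) (pK r (memb-true eK))
          ... | ()
          pw r | true | false = pF r (memb-true eF)
          pw r | false | true = pK r (memb-true eK)
          pw r | false | false = refl

        certified-replace : (∀ ℓ → shared ℓ ≡ true → owner ℓ ∈ Fl →
                      Σ (Ln I) λ ℓ' → Unshared ℓ' × On (solo ℓ') ℓ × owner ℓ' ∈ Kl) → Certified cov
        certified-replace D = certified sok
          where
          sok : ∀ ℓ → shared ℓ ≡ true → SharedOK ℓ
          sok ℓ s with memb (owner ℓ) Fl in eF | memb (owner ℓ) Kl in eK
          ... | false | false = inj₁ refl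
          ... | false | true with trans (sym s) (degree-3⇒unshared (owner ℓ) ℓ (pK (owner ℓ) (memb-true eK)) (owner-on ℓ))
          ... | ()
          sok ℓ s | true | _ with D ℓ s (memb-true eF)
          ... | ℓ' , s' , o , m = inj₂ (ℓ' , s' , o , help)
            where
            help : out (owner ℓ') ≡ true
            help rewrite memb-∈ m = Bool.∨-zeroʳ (memb (owner ℓ') Fl)

      -- A minimal cover of size n + 1: in rows r1, r2 replace the transversal
      -- cells by f1 = (r1, tcol r2) and f2 = (r2, c'), where c' is the column
      -- of r2 holding the symbol tsym r1, and add f3 = (r'', tcol r1), the cell
      -- of column tcol r1 holding tsym r2.  The transversal cell of the owner
      -- of column c' then keeps its symbol as private line, which needs H.
      module Special (colInj : ∀ r c c' → L r c ≡ L r c' → c ≡ c')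
                     (rowInj : ∀ r r' c → L r c ≡ L r' c → r ≡ r')
                     (r1 r2 c' r'' : I) (r12 : r1 ≢ r2)
                     (ec' : L r2 c' ≡ tsym r1) (er'' : L r'' (tcol r1) ≡ tsym r2)
                     (H : owner (sy (L r1 (tcol r2))) ≢ owner (cl c')) where
        c1 c2 s1 s2 : I
        c1 = tcol r1
        c2 = tcol r2
        s1 = tsym r1
        s2 = tsym r2
        f1 f2 f3 : Cell
        f1 = r1 , c2
        f2 = r2 , c'
        f3 = r'' , c1

        pcD : (r : I) → Dec (r ≡ r1) → Dec (r ≡ r2) → Cell
        pcD r (yes _) _ = f1
        pcD r (no _) (yes _) = f2
        pcD r (no _) (no _) = tcell r

        pc : I → Cell
        pc r = pcD r (r ≟ r1) (r ≟ r2)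

        data PC (r : I) (b : Cell) : Set where
          is1 : r ≡ r1 → b ≡ f1 → PC r b
          is2 : r ≡ r2 → b ≡ f2 → PC r b
          isT : r ≢ r1 → r ≢ r2 → b ≡ tcell r → PC r b

        pcD-cases : ∀ r d1 d2 → PC r (pcD r d1 d2)
        pcD-cases r (yes e) _ = is1 e refl
        pcD-cases r (no n1) (yes e) = is2 e refl
        pcD-cases r (no n1) (no n2) = isT n1 n2 refl

        pc-cases : ∀ r → PC r (pc r)
        pc-cases r = pcD-cases r (r ≟ r1) (r ≟ r2)

        pc-row : ∀ r → proj₁ (pc r) ≡ r
        pc-row r with pc-cases r
        ... | is1 e q = trans (cong proj₁ q) (sym e)
        ... | is2 e q = trans (cong proj₁ q) (sym e)
        ... | isT _ _ q = cong proj₁ q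

        ownC : ∀ r c → tcol r ≡ c → r ≡ owner (cl c)
        ownC r c e = owner-unique r (cl c) e
        ownS : ∀ r s → tsym r ≡ s → r ≡ owner (sy s)
        ownS r s e = owner-unique r (sy s) e

        c1≢c2 : c1 ≢ c2
        c1≢c2 e = r12 (trans (ownC r1 c2 e) (sym (ownC r2 c2 refl)))
        s1≢s2 : s1 ≢ s2
        s1≢s2 e = r12 (trans (ownS r1 s2 e) (sym (ownS r2 s2 refl)))
        c'≢c2 : c' ≢ c2
        c'≢c2 e = s1≢s2 (trans (sym ec') (cong (L r2) e))
        c'≢c1 : c' ≢ c1
        c'≢c1 e = r12 (sym (rowInj r2 r1 c1 (trans (trans (cong (L r2) (sym e)) ec') refl)))
        r''≢r2 : r'' ≢ r2
        r''≢r2 e = c1≢c2 (colInj r2 c1 c2 (trans (trans (cong (λ x → L x c1) (sym e)) er'') refl))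

        C : List Cell
        C = f3 ∷ map pc allI

        lenC : length C ≡ suc (length allI)
        lenC = cong suc (length-map pc allI)

        f3∉ : ∀ r → pc r ≢ f3
        f3∉ r q with pc-cases r
        ... | is1 e q' = c1≢c2 (sym (cong proj₂ (trans (sym q') q)))
        ... | is2 e q' = r''≢r2 (sym (cong proj₁ (trans (sym q') q)))
        ... | isT n1 n2 q' = n1 (trans (ownC r c1 (cong proj₂ (trans (sym q') q))) (sym (ownC r1 c1 refl)))

        C-u : Unique C
        C-u = All.tabulate (λ m e → help m e) ∷ unique-map-on pc allI (λ {x} {y} _ _ q → trans (sym (pc-row x)) (trans (cong proj₁ q) (pc-row y))) allI-u
          where
          help : ∀ {z} → z ∈ map pc allI → f3 ≡ z → ⊥
          help m e with ∈-map⁻ pc m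
          ... | r , _ , refl = f3∉ r (sym e)

        memC : ∀ {b} → b ∈ C → (b ≡ f3) ⊎ (Σ I λ r → b ≡ pc r)
        memC (here e) = inj₁ e
        memC (there m) with ∈-map⁻ pc m
        ... | r , _ , e = inj₂ (r , e)

        pcC : ∀ r → pc r ∈ C
        pcC r = there (∈-map⁺ pc (allI-c r))

        pc-r1 : pc r1 ≡ f1
        pc-r1 with pc-cases r1
        ... | is1 _ q' = q'
        ... | is2 e' _ = ⊥-elim (r12 e')
        ... | isT n1 _ _ = ⊥-elim (n1 refl)

        pc-r2 : pc r2 ≡ f2
        pc-r2 with pc-cases r2
        ... | is1 e' _ = ⊥-elim (r12 (sym e'))
        ... | is2 _ q' = q'
        ... | isT _ n2 _ = ⊥-elim (n2 refl)

        -- a line is covered by the entry replacing its owner's transversal cell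
        covers : ∀ ℓ → Any (λ b → On b ℓ) C
        covers ℓ with pc-cases (owner ℓ) | owner-on ℓ
        ... | isT n1 n2 q | o = lose (pcC (owner ℓ)) (subst (λ b → On b ℓ) (sym q) o)
        covers (rw x) | is1 e q | o = lose (pcC r1) (subst (λ b → On b (rw x)) (sym pc-r1) (trans (sym e) o))
        covers (cl x) | is1 e q | o = lose (here refl) (trans (cong tcol (sym e)) o)
        covers (sy x) | is1 e q | o = lose (pcC r2) (subst (λ b → On b (sy x)) (sym pc-r2) (trans ec' (trans (cong tsym (sym e)) o)))
        covers (rw x) | is2 e q | o = lose (pcC r2) (subst (λ b → On b (rw x)) (sym pc-r2) (trans (sym e) o))
        covers (cl x) | is2 e q | o = lose (pcC r1) (subst (λ b → On b (cl x)) (sym pc-r1) (trans (cong tcol (sym e)) o))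
        covers (sy x) | is2 e q | o = lose (here refl) (trans er'' (trans (cong tsym (sym e)) o))

        Priv : Cell → Set
        Priv = PrivateLine C

        priv-f3 : Priv f3
        priv-f3 = cl c1 , refl , help
          where
          help : ∀ b' → b' ∈ C → On b' (cl c1) → b' ≡ f3
          help b' m o with memC m
          ... | inj₁ e = e
          ... | inj₂ (r , refl) with pc-cases r
          ... | is1 _ q = ⊥-elim (c1≢c2 (sym (trans (sym (cong proj₂ q)) o)))
          ... | is2 _ q = ⊥-elim (c'≢c1 (trans (sym (cong proj₂ q)) o))
          ... | isT n1 _ q = ⊥-elim (n1 (trans (ownC r c1 (trans (sym (cong proj₂ q)) o)) (sym (ownC r1 c1 refl))))

        priv-f1 : Priv f1
        priv-f1 = cl c2 , refl , help
          where
          help : ∀ b' → b' ∈ C → On b' (cl c2) → b' ≡ f1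
          help b' m o with memC m
          ... | inj₁ refl = ⊥-elim (c1≢c2 o)
          ... | inj₂ (r , refl) with pc-cases r
          ... | is1 _ q = q
          ... | is2 _ q = ⊥-elim (c'≢c2 (trans (sym (cong proj₂ q)) o))
          ... | isT _ n2 q = ⊥-elim (n2 (trans (ownC r c2 (trans (sym (cong proj₂ q)) o)) (sym (ownC r2 c2 refl))))

        priv-f2 : Priv f2
        priv-f2 = rw r2 , refl , help
          where
          help : ∀ b' → b' ∈ C → On b' (rw r2) → b' ≡ f2
          help b' m o with memC m
          ... | inj₁ refl = ⊥-elim (r''≢r2 o)
          ... | inj₂ (r , refl) = trans (cong pc (trans (sym (pc-row r)) o)) pc-r2

        priv-T : ∀ r → r ≢ r1 → r ≢ r2 → Priv (tcell r)
        priv-T r n1 n2 with r ≟ owner (cl c')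
        ... | yes eo = sy (tsym r) , refl , help
          where
          help : ∀ b' → b' ∈ C → On b' (sy (tsym r)) → b' ≡ tcell r
          help b' m o with memC m
          ... | inj₁ refl = ⊥-elim (n2 (trans (ownS r s2 (sym (trans (sym er'') o))) (sym (ownS r2 s2 refl))))
          ... | inj₂ (r' , refl) with pc-cases r'
          ... | is1 _ q = ⊥-elim (H (trans (sym (ownS r (L r1 c2) (sym (trans (sym (cong (λ b → L (proj₁ b) (proj₂ b)) q)) o)))) eo))
          ... | is2 _ q = ⊥-elim (n1 (trans (ownS r s1 (sym (trans (sym ec') (trans (sym (cong (λ b → L (proj₁ b) (proj₂ b)) q)) o)))) (sym (ownS r1 s1 refl))))
          ... | isT _ _ q = trans q (cong tcell (trans (ownS r' (tsym r) (trans (sym (cong (λ b → L (proj₁ b) (proj₂ b)) q)) o)) (sym (ownS r (tsym r) refl))))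
        ... | no ne = cl (tcol r) , refl , help
          where
          help : ∀ b' → b' ∈ C → On b' (cl (tcol r)) → b' ≡ tcell r
          help b' m o with memC m
          ... | inj₁ refl = ⊥-elim (n1 (trans (ownC r c1 (sym o)) (sym (ownC r1 c1 refl))))
          ... | inj₂ (r' , refl) with pc-cases r'
          ... | is1 _ q = ⊥-elim (n2 (trans (ownC r c2 (sym (trans (sym (cong proj₂ q)) o))) (sym (ownC r2 c2 refl))))
          ... | is2 _ q = ⊥-elim (ne (ownC r c' (sym (trans (sym (cong proj₂ q)) o))))
          ... | isT _ _ q = trans q (cong tcell (trans (ownC r' (tcol r) (trans (sym (cong proj₂ q)) o)) (sym (ownC r (tcol r) refl))))

        privs : ∀ b → b ∈ C → Priv b
        privs b m with memC m
        ... | inj₁ refl = priv-f3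
        ... | inj₂ (r , refl) with pc-cases r
        ... | is1 refl q rewrite q = priv-f1
        ... | is2 refl q rewrite q = priv-f2
        ... | isT n1 n2 q rewrite q = priv-T r n1 n2

        goodC : Certified C
        goodC = record { uniq = C-u ; covers = covers ; privs = privs }

      -- Double counting: every line meets the transversal exactly once, so the
      -- shared lines are counted once each by summing, over all rows, the
      -- number of shared lines through the transversal cell; the degrees
      -- account for the remaining incidences.
      module Counting (SR SC SS : List I) (uR : Unique SR) (uC : Unique SC) (uS : Unique SS)
                      (hR : ∀ x → shared (rw x) ≡ true → x ∈ SR) (hR' : ∀ x → x ∈ SR → shared (rw x) ≡ true)
                      (hC : ∀ x → shared (cl x) ≡ true → x ∈ SC) (hC' : ∀ x → x ∈ SC → shared (cl x) ≡ true)
                      (hS : ∀ x → shared (sy x) ≡ true → x ∈ SS) (hS' : ∀ x → x ∈ SS → shared (sy x) ≡ true) where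
        P2 P3 : List I
        P2 = filter (λ r → degree r ℕP.≟ 2) allI
        P3 = filter (λ r → degree r ℕP.≟ 3) allI

        sharedAt : I → ℕ
        sharedAt r = ind (shared (rw r)) + ind (shared (cl (tcol r))) + ind (shared (sy (tsym r)))

        degree+sharedAt : ∀ r → degree r + sharedAt r ≡ 3
        degree+sharedAt r with shared (rw r) | shared (cl (tcol r)) | shared (sy (tsym r))
        ... | true | true | true = refl
        ... | true | true | false = refl
        ... | true | false | true = refl
        ... | true | false | false = refl
        ... | false | true | true = refl
        ... | false | true | false = refl
        ... | false | false | true = refl
        ... | false | false | false = refl

        SCr SSr : List I
        SCr = map (λ c → owner (cl c)) SC
        SSr = map (λ s → owner (sy s)) SS

        uCr : Unique SCr
        uCr = unique-map-on (λ c → owner (cl c)) SC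
          (λ {x} {y} _ _ q → trans (sym (owner-on (cl x))) (trans (cong tcol q) (owner-on (cl y)))) uC
        uSr : Unique SSr
        uSr = unique-map-on (λ s → owner (sy s)) SS
          (λ {x} {y} _ _ q → trans (sym (owner-on (sy x))) (trans (cong tsym q) (owner-on (sy y)))) uS

        memCr : ∀ r → (shared (cl (tcol r)) ≡ true → r ∈ SCr) × (r ∈ SCr → shared (cl (tcol r)) ≡ true)
        memCr r = (λ e → subst (_∈ SCr) (sym (owner-unique r (cl (tcol r)) refl)) (∈-map⁺ (λ c → owner (cl c)) (hC (tcol r) e))) ,
                  shared-col
          where
          shared-col : r ∈ SCr → shared (cl (tcol r)) ≡ true
          shared-col m with ∈-map⁻ (λ c → owner (cl c)) m
          ... | c , cm , refl = subst (λ x → shared (cl x) ≡ true) (sym (owner-on (cl c))) (hC' c cm)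

        memSr : ∀ r → (shared (sy (tsym r)) ≡ true → r ∈ SSr) × (r ∈ SSr → shared (sy (tsym r)) ≡ true)
        memSr r = (λ e → subst (_∈ SSr) (sym (owner-unique r (sy (tsym r)) refl)) (∈-map⁺ (λ s → owner (sy s)) (hS (tsym r) e))) ,
                  shared-sym
          where
          shared-sym : r ∈ SSr → shared (sy (tsym r)) ≡ true
          shared-sym m with ∈-map⁻ (λ s → owner (sy s)) m
          ... | s , sm , refl = subst (λ x → shared (sy x) ≡ true) (sym (owner-on (sy s))) (hS' s sm)

        count : List I → ℕ
        count S = ΣL (indm S) allI

        count-sublist-allI : ∀ S → Unique S → count S ≡ length S
        count-sublist-allI S u = count-sublist allI S allI-u u (λ x _ → allI-c x)

        sum-sharedAt : ΣL sharedAt allI ≡ length SR + length SC + length SS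
        sum-sharedAt = begin
          ΣL sharedAt allI
            ≡⟨ ΣL-cong allI (λ r _ → cong₂ _+_ (cong₂ _+_ (ind≡indm _ SR r (hR r) (hR' r)) (ind≡indm _ SCr r (proj₁ (memCr r)) (proj₂ (memCr r))))
                                               (ind≡indm _ SSr r (proj₁ (memSr r)) (proj₂ (memSr r)))) ⟩
          ΣL (λ r → indm SR r + indm SCr r + indm SSr r) allI
            ≡⟨ trans (ΣL-+ _ _ allI) (cong (_+ count SSr) (ΣL-+ _ _ allI)) ⟩
          count SR + count SCr + count SSr
            ≡⟨ cong₂ _+_ (cong₂ _+_ (count-sublist-allI SR uR) (count-sublist-allI SCr uCr)) (count-sublist-allI SSr uSr) ⟩
          length SR + length SCr + length SSr
            ≡⟨ cong₂ _+_ (cong (length SR +_) (length-map _ SC)) (length-map _ SS) ⟩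
          length SR + length SC + length SS ∎
          where open ≡-Reasoning

        degree-split : ∀ r → degree r ≡ 1 + ind (does (degree r ℕP.≟ 2)) + 2 * ind (does (degree r ℕP.≟ 3))
        degree-split r with degree r | degree≥1 r | degree≤3 r
        ... | 1 | _ | _ = refl
        ... | 2 | _ | _ = refl
        ... | 3 | _ | _ = refl
        ... | 0 | () | _
        ... | suc (suc (suc (suc k))) | _ | ℕ.s≤s (ℕ.s≤s (ℕ.s≤s ()))

        sum-degree : ΣL degree allI ≡ length allI + length P2 + 2 * length P3
        sum-degree = begin
          ΣL degree allI
            ≡⟨ ΣL-cong allI (λ r _ → degree-split r) ⟩
          ΣL (λ r → 1 + ind (does (degree r ℕP.≟ 2)) + 2 * ind (does (degree r ℕP.≟ 3))) allI
            ≡⟨ trans (ΣL-+ _ _ allI) (cong₂ _+_ (ΣL-+ _ _ allI) (ΣL-* 2 _ allI)) ⟩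
          ΣL (λ _ → 1) allI + ΣL (λ r → ind (does (degree r ℕP.≟ 2))) allI + 2 * ΣL (λ r → ind (does (degree r ℕP.≟ 3))) allI
            ≡⟨ cong₂ _+_ (cong₂ _+_ (ΣL-1 allI) (count-filter (λ r → degree r ℕP.≟ 2) allI))
                         (cong (2 *_) (count-filter (λ r → degree r ℕP.≟ 3) allI)) ⟩
          length allI + length P2 + 2 * length P3 ∎
          where open ≡-Reasoning

        counting : length allI + length P2 + 2 * length P3 + (length SR + length SC + length SS) ≡ 3 * length allI
        counting = begin
          length allI + length P2 + 2 * length P3 + (length SR + length SC + length SS)
            ≡⟨ sym (cong₂ _+_ sum-degree sum-sharedAt) ⟩
          ΣL degree allI + ΣL sharedAt allI
            ≡⟨ sym (ΣL-+ degree sharedAt allI) ⟩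
          ΣL (λ r → degree r + sharedAt r) allI
            ≡⟨ ΣL-cong allI (λ r _ → trans (degree+sharedAt r) (sym (ℕP.*-identityʳ 3))) ⟩
          ΣL (λ _ → 3 * 1) allI
            ≡⟨ ΣL-* 3 (λ _ → 1) allI ⟩
          3 * ΣL (λ _ → 1) allI
            ≡⟨ cong (3 *_) (ΣL-1 allI) ⟩
          3 * length allI ∎
          where open ≡-Reasoning

module Transport where

  open import Defs hiding (Cell) renaming (sym to symL)
  import Defs
  open TransversalCovers using (Ln; rw; cl; sy; module Square)
  open import Data.Nat using (ℕ)
  open import Data.Fin using (Fin)
  open import Data.Fin.Properties using (_≟_)
  open import Data.Product using (∃; _×_; _,_; proj₁; proj₂)
  open import Data.Product.Properties using (≡-dec)
  open import Data.List using (List; map; length)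
  open import Data.List.Properties using (length-map)
  import Data.List.Relation.Unary.Any as Any
  import Data.List.Relation.Unary.Any.Properties as Any
  import Data.List.Relation.Unary.Unique.Propositional.Properties as Unique
  open import Data.List.Membership.Propositional using (_∈_; find)
  open import Data.List.Membership.Propositional.Properties using (∈-map⁻; ∈-filter⁻)
  open import Relation.Nullary using (¬_)
  open import Relation.Nullary.Decidable using (¬?)
  open import Relation.Binary.PropositionalEquality

  module Tr {I : Set} (n : ℕ) (to : Fin n → I) (from : I → Fin n)
    (to-from : ∀ x → to (from x) ≡ x) (from-to : ∀ i → from (to i) ≡ i)
    (L : I → I → I) (colOf rowOf : I → I → I)
    (colOf-l : ∀ r c → colOf r (L r c) ≡ c) (colOf-r : ∀ r s → L r (colOf r s) ≡ s)
    (rowOf-l : ∀ r c → rowOf c (L r c) ≡ r) (rowOf-r : ∀ c s → L (rowOf c s) c ≡ s) where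

    open Square L

    L' : Fin n → Fin n → Fin n
    L' i j = from (L (to i) (to j))

    LS : LatinSquare n
    LS = record { L = L' ; rowOnce = row-solution ; colOnce = col-solution }
      where
      row-solution : ∀ i s → ∃ λ j → L' i j ≡ s × (∀ j' → L' i j' ≡ s → j' ≡ j)
      row-solution i s = from (colOf (to i) (to s)) ,
        trans (cong (λ c → from (L (to i) c)) (to-from _)) (trans (cong from (colOf-r (to i) (to s))) (from-to s)) ,
        λ j' e → trans (sym (from-to j')) (cong from (trans (sym (colOf-l (to i) (to j')))
                   (cong (colOf (to i)) (trans (sym (to-from _)) (cong to e)))))
      col-solution : ∀ j s → ∃ λ i → L' i j ≡ s × (∀ i' → L' i' j ≡ s → i' ≡ i)
      col-solution j s = from (rowOf (to j) (to s)) ,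
        trans (cong (λ r → from (L r (to j))) (to-from _)) (trans (cong from (rowOf-r (to j) (to s))) (from-to s)) ,
        λ i' e → trans (sym (from-to i')) (cong from (trans (sym (rowOf-l (to i') (to j)))
                   (cong (rowOf (to j)) (trans (sym (to-from _)) (cong to e)))))

    cell : Cell → Defs.Cell n
    cell (r , c) = from r , from c

    cell-injective : ∀ {x y} → cell x ≡ cell y → x ≡ y
    cell-injective {r , c} {r' , c'} e =
      cong₂ _,_ (trans (sym (to-from r)) (trans (cong (λ z → to (proj₁ z)) e) (to-from r')))
                (trans (sym (to-from c)) (trans (cong (λ z → to (proj₂ z)) e) (to-from c')))

    line : Line n → Ln I
    line (row i) = rw (to i)
    line (col i) = cl (to i)
    line (symL i) = sy (to i)

    unline : Ln I → Line n
    unline (rw x) = row (from x)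
    unline (cl x) = col (from x)
    unline (sy x) = symL (from x)

    line-unline : ∀ ℓ → line (unline ℓ) ≡ ℓ
    line-unline (rw x) = cong rw (to-from x)
    line-unline (cl x) = cong cl (to-from x)
    line-unline (sy x) = cong sy (to-from x)

    on⇒ : ∀ b ℓ → On b (line ℓ) → OnLine LS (cell b) ℓ
    on⇒ (r , c) (row i) o = trans (cong from o) (from-to i)
    on⇒ (r , c) (col i) o = trans (cong from o) (from-to i)
    on⇒ (r , c) (symL i) o = trans (cong from (trans (cong₂ L (to-from r) (to-from c)) o)) (from-to i)

    on⇐ : ∀ b ℓ → OnLine LS (cell b) ℓ → On b (line ℓ)
    on⇐ (r , c) (row i) o = trans (sym (to-from r)) (cong to o)
    on⇐ (r , c) (col i) o = trans (sym (to-from c)) (cong to o)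
    on⇐ (r , c) (symL i) o = trans (sym (cong₂ L (to-from r) (to-from c))) (trans (sym (to-from _)) (cong to o))

    -- Removing an entry leaves its private line uncovered, so the cover is minimal.
    minimal-cover : (C : List Cell) → Certified C → HasMinimalCover LS (length C)
    minimal-cover C cert = map cell C , (Unique.map⁺ cell-injective (Certified.uniq cert) , covers , minimal) , length-map cell C
      where
      covers : IsCover LS (map cell C)
      covers ℓ = Any.map⁺ (Any.map (λ {b} o → on⇒ b ℓ o) (Certified.covers cert (line ℓ)))
      minimal : ∀ e → e ∈ map cell C → ¬ IsCover LS (map cell C without e)
      minimal e m isCover with ∈-map⁻ cell m
      ... | b , bm , refl with Certified.privs cert b bm
      ... | ℓ , _ , only-b with find (isCover (unline ℓ))
      ... | e' , e'∈ , on' with ∈-filter⁻ (λ x → ¬? (≡-dec _≟_ _≟_ x (cell b))) e'∈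
      ... | e'∈C , e'≢ with ∈-map⁻ cell e'∈C
      ... | b' , bm' , refl = e'≢ (cong cell (only-b b' bm' (subst (On b') (line-unline ℓ) (on⇐ b' (unline ℓ) on'))))


module Parity where

  open import Data.Nat using (ℕ; zero; suc; _+_)
  open import Data.Nat.Properties using (+-suc)
  open import Data.Product using (Σ; _,_)
  open import Data.Sum using (_⊎_; inj₁; inj₂)
  open import Relation.Binary.PropositionalEquality

  parity : ∀ v → Σ ℕ λ q → (v ≡ q + q) ⊎ (v ≡ suc (q + q))
  parity zero = 0 , inj₁ refl
  parity (suc v) with parity v
  ... | q , inj₁ e = q , inj₂ (cong suc e)
  ... | q , inj₂ e = suc q , inj₁ (trans (cong suc e) (cong suc (sym (+-suc q q))))


module SizeRange where

  open import Data.Nat using (ℕ; zero; suc; _+_; _*_; _∸_; _≤_; _≤?_)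
  import Data.Nat.Properties as ℕP
  open import Data.Product using (_,_)
  open import Data.Sum using (inj₁; inj₂)
  open import Relation.Nullary using (yes; no)
  open import Relation.Binary.PropositionalEquality
  open Parity

  module Sizes (N M2 M3 : ℕ) (R : ℕ → Set)
    (evens : ∀ q → q ≤ M3 → R (N + (q + q)))
    (odds : ∀ q → suc q ≤ M3 → R (N + suc (suc q + suc q)))
    (tail : ∀ j → j ≤ M2 → R (N + (j + 2 * M3)))
    (one : R (N + 1)) where

    from-tail : ∀ v → v ≤ M2 + 2 * M3 → 2 * M3 ≤ v → R (N + v)
    from-tail v le ge = subst (λ x → R (N + x)) (ℕP.m∸n+n≡m ge)
      (tail (v ∸ 2 * M3) (subst (v ∸ 2 * M3 ≤_) (ℕP.m+n∸n≡m M2 (2 * M3)) (ℕP.∸-monoˡ-≤ (2 * M3) le)))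

    double-≤ : ∀ {a b} → a ≤ b → 2 * a ≤ b + b
    double-≤ {a} {b} le = subst (_≤ b + b) (cong (a +_) (sym (ℕP.+-identityʳ a))) (ℕP.+-mono-≤ le le)

    every-size : ∀ v → v ≤ M2 + 2 * M3 → R (N + v)
    every-size v le with parity v
    every-size v le | q , inj₁ refl with q ≤? M3
    ... | yes q≤ = evens q q≤
    ... | no q≰ = from-tail (q + q) le (double-≤ (ℕP.<⇒≤ (ℕP.≰⇒> q≰)))
    every-size v le | zero , inj₂ refl = one
    every-size v le | suc q , inj₂ refl with suc q ≤? M3
    ... | yes q≤ = odds q q≤
    ... | no q≰ = from-tail (suc (suc q + suc q)) le (ℕP.≤-trans (double-≤ (ℕP.<⇒≤ (ℕP.≰⇒> q≰))) (ℕP.n≤1+n _))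


-- The corner block of the construction: for every t ≥ 3 a Latin square C of
-- order t on Fin t, given with solvers for the missing column (Cr) and row
-- (Cc), together with a transversal {(k , π k)}: π is a permutation and κi
-- inverts the symbol map k ↦ C k (π k).  For odd t the addition table of ℤ/tℤ
-- works (with π the identity, since doubling is invertible); for even t the
-- addition table of ℤ/(t-1)ℤ is prolonged by a new symbol along its diagonal.
module CornerSquares where

  open import Data.Nat as ℕ using (ℕ; zero; suc)
  import Data.Nat.Properties as ℕP
  open import Data.Nat.DivMod using (m*n%n≡0)
  open import Data.Fin using (Fin; toℕ) renaming (zero to fz; suc to fs)
  open import Data.Fin.Properties using (_≟_)
  open import Data.Product using (_,_)
  open import Data.Sum using (inj₁; inj₂)
  open import Data.Empty using (⊥-elim)
  open import Relation.Nullary using (¬_; Dec; yes; no)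
  open import Relation.Binary.PropositionalEquality
  open IntegersModulo
  open AbelianGroupSolver
  open Parity

  record Corner (t : ℕ) : Set where
    field
      C : Fin t → Fin t → Fin t
      Cr : Fin t → Fin t → Fin t
      Cc : Fin t → Fin t → Fin t
      Cr-l : ∀ k j → Cr k (C k j) ≡ j
      Cr-r : ∀ k z → C k (Cr k z) ≡ z
      Cc-l : ∀ k j → Cc j (C k j) ≡ k
      Cc-r : ∀ j z → C (Cc j z) j ≡ z
      π πi : Fin t → Fin t
      π-l : ∀ k → πi (π k) ≡ k
      π-r : ∀ j → π (πi j) ≡ j
      κi : Fin t → Fin t
      κ-l : ∀ k → κi (C k (π k)) ≡ k
      κ-r : ∀ z → C (κi z) (π (κi z)) ≡ z

  -- ℤ/mℤ for the odd modulus m = 2j + 3, where halving is multiplication by j + 2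
  module OddModulus (j : ℕ) where
    open ZMod (suc (suc (j ℕ.+ j))) public
    open Solver +-isAbelianGroup public using (solve; _⊜_; _:+_; :-_; :0; _·_; ×-homo-+; ×-distrib-+)

    1≢0 : ¬ (1# ≡ 0#)
    1≢0 ()

    ·-as-reduce : ∀ k a → k · a ≡ reduce (k ℕ.* toℕ a)
    ·-as-reduce zero a = refl
    ·-as-reduce (suc k) a = trans (cong (a +_) (·-as-reduce k a)) (reduce-+ʳ (toℕ a) (k ℕ.* toℕ a))

    m·≡0 : ∀ a → m · a ≡ 0#
    m·≡0 a = trans (·-as-reduce m a) (reduce-cong (m ℕ.* toℕ a) 0
               (trans (cong (ℕ._% m) (ℕP.*-comm m (toℕ a))) (m*n%n≡0 (toℕ a) m)))

    h : ℕ
    h = suc (suc j)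

    half : Z → Z
    half s = h · s

    hh : h ℕ.+ h ≡ suc m
    hh = cong suc (cong suc (trans (ℕP.+-suc j (suc j)) (cong suc (ℕP.+-suc j j))))

    half-double : ∀ s → half s + half s ≡ s
    half-double s = trans (sym (×-homo-+ s h h)) (trans (cong (_· s) hh) (trans (cong (s +_) (m·≡0 s)) (+-identityʳ s)))

    half-of-double : ∀ a → half (a + a) ≡ a
    half-of-double a = trans (×-distrib-+ a a h) (half-double a)

  oddCorner : ∀ j → Corner (suc (suc (suc (j ℕ.+ j))))
  oddCorner j = record
    { C = _+_ ; Cr = λ k z → z + (- k) ; Cc = λ k z → z + (- k)
    ; Cr-l = λ k j → solve 2 (λ k j → k :+ j :+ :- k ⊜ j) refl k j
    ; Cr-r = λ k z → solve 2 (λ k z → k :+ (z :+ :- k) ⊜ z) refl k z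
    ; Cc-l = λ k j → solve 2 (λ k j → k :+ j :+ :- j ⊜ k) refl k j
    ; Cc-r = λ j z → solve 2 (λ j z → z :+ :- j :+ j ⊜ z) refl j z
    ; π = λ x → x ; πi = λ x → x ; π-l = λ _ → refl ; π-r = λ _ → refl
    ; κi = half ; κ-l = half-of-double ; κ-r = λ z → half-double z }
    where open OddModulus j

  module Even (j : ℕ) where
    open OddModulus j
    T : Set
    T = Fin (suc m)

    Cd : (a b : Z) → Dec (a ≡ b) → T
    Cd a b (yes _) = fz
    Cd a b (no _) = fs (a + b)

    C : T → T → T
    C fz fz = fz
    C fz (fs b) = fs (b + b)
    C (fs a) fz = fs (a + a)
    C (fs a) (fs b) = Cd a b (a ≟ b)

    Crd : (a s : Z) → Dec (s ≡ a + a) → T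
    Crd a s (yes _) = fz
    Crd a s (no _) = fs (s + (- a))

    Cr : T → T → T
    Cr fz fz = fz
    Cr fz (fs s) = fs (half s)
    Cr (fs a) fz = fs a
    Cr (fs a) (fs s) = Crd a s (s ≟ a + a)

    C-sym : ∀ x y → C x y ≡ C y x
    C-sym fz fz = refl
    C-sym fz (fs b) = refl
    C-sym (fs a) fz = refl
    C-sym (fs a) (fs b) with a ≟ b | b ≟ a
    ... | yes _ | yes _ = refl
    ... | yes e | no n = ⊥-elim (n (sym e))
    ... | no n | yes e = ⊥-elim (n (sym e))
    ... | no _ | no _ = cong fs (+-comm a b)

    Cr-l : ∀ k j → Cr k (C k j) ≡ j
    Cr-l fz fz = refl
    Cr-l fz (fs b) = cong fs (half-of-double b)
    Cr-l (fs a) fz with a + a ≟ a + a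
    ... | yes _ = refl
    ... | no n = ⊥-elim (n refl)
    Cr-l (fs a) (fs b) with a ≟ b
    ... | yes e = cong fs e
    ... | no n with a + b ≟ a + a
    ... | yes e = ⊥-elim (n (sym (trans (solve 2 (λ a b → b ⊜ a :+ b :+ :- a) refl a b) (trans (cong (_+ (- a)) e) (solve 1 (λ a → a :+ a :+ :- a ⊜ a) refl a)))))
    ... | no _ = cong fs (solve 2 (λ a b → a :+ b :+ :- a ⊜ b) refl a b)

    Cr-r : ∀ k z → C k (Cr k z) ≡ z
    Cr-r fz fz = refl
    Cr-r fz (fs s) = cong fs (half-double s)
    Cr-r (fs a) fz with a ≟ a
    ... | yes _ = refl
    ... | no n = ⊥-elim (n refl)
    Cr-r (fs a) (fs s) with s ≟ a + a
    ... | yes e = cong fs (sym e)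
    ... | no n with a ≟ s + (- a)
    ... | yes e = ⊥-elim (n (trans (solve 2 (λ a s → s ⊜ s :+ :- a :+ a) refl a s) (cong (_+ a) (sym e))))
    ... | no _ = cong fs (solve 2 (λ a s → a :+ (s :+ :- a) ⊜ s) refl a s)

    π πi : T → T
    π fz = fz
    π (fs a) = fs (a + 1#)
    πi fz = fz
    πi (fs a) = fs (a + (- 1#))

    κi : T → T
    κi fz = fz
    κi (fs s) = fs (half (s + (- 1#)))

    a≢a+1 : ∀ a → ¬ (a ≡ a + 1#)
    a≢a+1 a e = 1≢0 (trans (solve 2 (λ a o → o ⊜ a :+ o :+ :- a) refl a 1#) (trans (cong (_+ (- a)) (sym e)) (-‿inverseʳ a)))

    Cnext : ∀ a → C (fs a) (fs (a + 1#)) ≡ fs (a + (a + 1#))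
    Cnext a with a ≟ a + 1#
    ... | yes e = ⊥-elim (a≢a+1 a e)
    ... | no _ = refl

    corner : Corner (suc m)
    corner = record
      { C = C ; Cr = Cr ; Cc = Cr
      ; Cr-l = Cr-l ; Cr-r = Cr-r
      ; Cc-l = λ k j → trans (cong (Cr j) (C-sym k j)) (Cr-l j k)
      ; Cc-r = λ j z → trans (C-sym (Cr j z) j) (Cr-r j z)
      ; π = π ; πi = πi
      ; π-l = λ { fz → refl ; (fs a) → cong fs (solve 2 (λ a o → a :+ o :+ :- o ⊜ a) refl a 1#) }
      ; π-r = λ { fz → refl ; (fs a) → cong fs (solve 2 (λ a o → a :+ :- o :+ o ⊜ a) refl a 1#) }
      ; κi = κi
      ; κ-l = λ { fz → refl ; (fs a) → trans (cong κi (Cnext a))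
                    (cong fs (trans (cong half (solve 2 (λ a o → a :+ (a :+ o) :+ :- o ⊜ a :+ a) refl a 1#)) (half-of-double a))) }
      ; κ-r = λ { fz → refl ; (fs s) → trans (Cnext (half (s + (- 1#))))
                    (cong fs (trans (solve 2 (λ h o → h :+ (h :+ o) ⊜ h :+ h :+ o) refl (half (s + (- 1#))) 1#)
                       (trans (cong (_+ 1#) (half-double (s + (- 1#)))) (solve 2 (λ s o → s :+ :- o :+ o ⊜ s) refl s 1#)))) }
      }

  evenCorner : ∀ j → Corner (suc (suc (suc (suc (j ℕ.+ j)))))
  evenCorner j = Even.corner j

  cornerFor : ∀ k' → Corner (suc (suc (suc k')))
  cornerFor k' with parity k'
  ... | q , inj₁ refl = oddCorner q
  ... | q , inj₂ refl = evenCorner q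


module Construction where

  open import Data.Nat as ℕ using (ℕ; suc)
  import Data.Nat.Properties as ℕP
  open import Data.Fin using (Fin; splitAt; join; combine; remQuot)
  open import Data.Fin.Properties using (_≟_; splitAt-join; join-splitAt; remQuot-combine; combine-remQuot)
  open import Data.List using (List; []; _∷_; map; length; allFin; take)
  import Data.List.Properties as LP
  open import Data.List.Relation.Unary.Any using (here; there)
  open import Data.List.Relation.Unary.All using ([]; _∷_)
  import Data.List.Relation.Unary.All as All
  open import Data.List.Relation.Unary.AllPairs using ([]; _∷_)
  open import Data.List.Membership.Propositional using (_∈_)
  open import Data.List.Membership.Propositional.Properties using (∈-map⁺; ∈-map⁻; ∈-allFin; ∈-filter⁺; ∈-filter⁻)
  open import Data.List.Relation.Unary.Unique.Propositional using (Unique)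
  import Data.List.Relation.Unary.Unique.Propositional.Properties as UP
  open import Data.Product using (Σ; _×_; _,_; proj₁; proj₂)
  open import Data.Sum using (_⊎_; inj₁; inj₂; [_,_]′)
  open import Data.Empty using (⊥; ⊥-elim)
  open import Relation.Nullary using (¬_; Dec; yes; no; does)
  open import Relation.Nullary.Decidable using (¬?; dec-true; dec-false)
  open import Relation.Binary.PropositionalEquality
  open IntegersModulo
  open AbelianGroupSolver
  open CornerSquares using (Corner)
  open import Defs using (LatinSquare; HasMinimalCover)
  open import Data.Sum.Properties using () renaming (≡-dec to ⊎-≡-dec)
  open import Data.Product.Properties using () renaming (≡-dec to ×-≡-dec)
  open ListFacts using (ind; take-⊆; length-take-≤; module Indicators)
  open TransversalCovers using (Ln; rw; cl; sy)
  open import Data.Bool using (Bool; true; false; not)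
  open import Relation.Binary.Definitions using (DecidableEquality)
  open import Data.Nat.Tactic.RingSolver using (solve-∀)

  module Order (k' : ℕ) (Co : Corner (suc (suc (suc k')))) where
    open ZMod (suc (suc k'))
    open Corner Co
    open Solver +-isAbelianGroup using (solve; _⊜_; _:+_; :-_; :0; ⁻¹-involutive; inverseʳ-unique)

    infixl 6 _-_
    _-_ : Z → Z → Z
    a - b = a + (- b)

    G : Set
    G = Z × Z

    I : Set
    I = G ⊎ Z

    gridBlockD : (a1 a2 b1 b2 : Z) → Dec (b2 ≡ a1 + a2) → I
    gridBlockD a1 a2 b1 b2 (yes _) = inj₂ (b1 - a2)
    gridBlockD a1 a2 b1 b2 (no _) = inj₁ (a1 + b1 , a2 + b2)

    gridBlock : Z → Z → Z → Z → I
    gridBlock a1 a2 b1 b2 = gridBlockD a1 a2 b1 b2 (b2 ≟ a1 + a2)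

    gridBlock-diag : ∀ a1 a2 b1 b2 → b2 ≡ a1 + a2 → gridBlock a1 a2 b1 b2 ≡ inj₂ (b1 - a2)
    gridBlock-diag a1 a2 b1 b2 e with b2 ≟ a1 + a2
    ... | yes _ = refl
    ... | no n = ⊥-elim (n e)

    gridBlock-off : ∀ a1 a2 b1 b2 → ¬ (b2 ≡ a1 + a2) → gridBlock a1 a2 b1 b2 ≡ inj₁ (a1 + b1 , a2 + b2)
    gridBlock-off a1 a2 b1 b2 n with b2 ≟ a1 + a2
    ... | yes e = ⊥-elim (n e)
    ... | no _ = refl

    L : I → I → I
    L (inj₁ (a1 , a2)) (inj₁ (b1 , b2)) = gridBlock a1 a2 b1 b2
    L (inj₁ (a1 , a2)) (inj₂ j) = inj₁ (a1 + a2 + j , a1 + a2 + a2)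
    L (inj₂ x) (inj₁ (b1 , b2)) = inj₁ (b2 + x , b1 + b2 - x)
    L (inj₂ x) (inj₂ j) = inj₂ (C x j)

    cGd : (a1 a2 d1 d2 : Z) → Dec (d2 - a2 ≡ a1 + a2) → I
    cGd a1 a2 d1 d2 (yes _) = inj₂ (d1 - a1 - a2)
    cGd a1 a2 d1 d2 (no _) = inj₁ (d1 - a1 , d2 - a2)

    colOf : I → I → I
    colOf (inj₁ (a1 , a2)) (inj₂ z) = inj₁ (z + a2 , a1 + a2)
    colOf (inj₁ (a1 , a2)) (inj₁ (d1 , d2)) = cGd a1 a2 d1 d2 (d2 - a2 ≟ a1 + a2)
    colOf (inj₂ x) (inj₁ (d1 , d2)) = inj₁ (d2 - d1 + x + x , d1 - x)
    colOf (inj₂ x) (inj₂ z) = inj₂ (Cr x z)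

    rGd : (b1 b2 d1 d2 : Z) → Dec (b2 ≡ (d1 - b1) + (d2 - b2)) → I
    rGd b1 b2 d1 d2 (yes _) = inj₂ (d1 - b2)
    rGd b1 b2 d1 d2 (no _) = inj₁ (d1 - b1 , d2 - b2)

    rowOf : I → I → I
    rowOf (inj₁ (b1 , b2)) (inj₂ z) = inj₁ (b2 - b1 + z , b1 - z)
    rowOf (inj₁ (b1 , b2)) (inj₁ (d1 , d2)) = rGd b1 b2 d1 d2 (b2 ≟ (d1 - b1) + (d2 - b2))
    rowOf (inj₂ j) (inj₁ (d1 , d2)) = inj₁ ((d1 - j) + (d1 - j) - d2 , d2 - (d1 - j))
    rowOf (inj₂ j) (inj₂ z) = inj₂ (Cc j z)

    pair≡ : ∀ {a b c d : Z} → a ≡ c → b ≡ d → _≡_ {A = I} (inj₁ (a , b)) (inj₁ (c , d))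
    pair≡ refl refl = refl

    colOf-l : ∀ r c → colOf r (L r c) ≡ c
    colOf-l (inj₁ (a1 , a2)) (inj₁ (b1 , b2)) with b2 ≟ a1 + a2
    ... | yes e = pair≡ (solve 2 (λ b1 a2 → b1 :+ :- a2 :+ a2 ⊜ b1) refl b1 a2) (sym e)
    ... | no n with (a2 + b2) - a2 ≟ a1 + a2
    ... | yes e' = ⊥-elim (n (trans (solve 2 (λ a2 b2 → b2 ⊜ a2 :+ b2 :+ :- a2) refl a2 b2) e'))
    ... | no _ = pair≡ (solve 2 (λ a1 b1 → a1 :+ b1 :+ :- a1 ⊜ b1) refl a1 b1) (solve 2 (λ a2 b2 → a2 :+ b2 :+ :- a2 ⊜ b2) refl a2 b2)
    colOf-l (inj₁ (a1 , a2)) (inj₂ j) with (a1 + a2 + a2) - a2 ≟ a1 + a2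
    ... | yes _ = cong inj₂ (solve 3 (λ a1 a2 j → a1 :+ a2 :+ j :+ :- a1 :+ :- a2 ⊜ j) refl a1 a2 j)
    ... | no n = ⊥-elim (n (solve 2 (λ a1 a2 → a1 :+ a2 :+ a2 :+ :- a2 ⊜ a1 :+ a2) refl a1 a2))
    colOf-l (inj₂ x) (inj₁ (b1 , b2)) = pair≡ (solve 3 (λ b1 b2 x → b1 :+ b2 :+ :- x :+ :- (b2 :+ x) :+ x :+ x ⊜ b1) refl b1 b2 x)
                                             (solve 2 (λ b2 x → b2 :+ x :+ :- x ⊜ b2) refl b2 x)
    colOf-l (inj₂ x) (inj₂ j) = cong inj₂ (Cr-l x j)

    colOf-r : ∀ r s → L r (colOf r s) ≡ s
    colOf-r (inj₁ (a1 , a2)) (inj₂ z) = trans (gridBlock-diag a1 a2 (z + a2) (a1 + a2) refl) (cong inj₂ (solve 2 (λ z a2 → z :+ a2 :+ :- a2 ⊜ z) refl z a2))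
    colOf-r (inj₁ (a1 , a2)) (inj₁ (d1 , d2)) with d2 - a2 ≟ a1 + a2
    ... | yes e = pair≡ (solve 3 (λ a1 a2 d1 → a1 :+ a2 :+ (d1 :+ :- a1 :+ :- a2) ⊜ d1) refl a1 a2 d1)
                        (trans (cong (_+ a2) (sym e)) (solve 2 (λ a2 d2 → d2 :+ :- a2 :+ a2 ⊜ d2) refl a2 d2))
    ... | no n = trans (gridBlock-off a1 a2 (d1 - a1) (d2 - a2) n)
                   (pair≡ (solve 2 (λ a1 d1 → a1 :+ (d1 :+ :- a1) ⊜ d1) refl a1 d1) (solve 2 (λ a2 d2 → a2 :+ (d2 :+ :- a2) ⊜ d2) refl a2 d2))
    colOf-r (inj₂ x) (inj₁ (d1 , d2)) = pair≡ (solve 2 (λ d1 x → d1 :+ :- x :+ x ⊜ d1) refl d1 x)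
                                             (solve 3 (λ d1 d2 x → d2 :+ :- d1 :+ x :+ x :+ (d1 :+ :- x) :+ :- x ⊜ d2) refl d1 d2 x)
    colOf-r (inj₂ x) (inj₂ z) = cong inj₂ (Cr-r x z)

    rowOf-l : ∀ r c → rowOf c (L r c) ≡ r
    rowOf-l (inj₁ (a1 , a2)) (inj₁ (b1 , b2)) with b2 ≟ a1 + a2
    ... | yes e = pair≡ (trans (cong (λ u → u - b1 + (b1 - a2)) e) (solve 3 (λ a1 a2 b1 → a1 :+ a2 :+ :- b1 :+ (b1 :+ :- a2) ⊜ a1) refl a1 a2 b1))
                        (solve 2 (λ b1 a2 → b1 :+ :- (b1 :+ :- a2) ⊜ a2) refl b1 a2)
    ... | no n with b2 ≟ ((a1 + b1) - b1) + ((a2 + b2) - b2)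
    ... | yes e' = ⊥-elim (n (trans e' (solve 4 (λ a1 a2 b1 b2 → a1 :+ b1 :+ :- b1 :+ (a2 :+ b2 :+ :- b2) ⊜ a1 :+ a2) refl a1 a2 b1 b2)))
    ... | no _ = pair≡ (solve 2 (λ a1 b1 → a1 :+ b1 :+ :- b1 ⊜ a1) refl a1 b1) (solve 2 (λ a2 b2 → a2 :+ b2 :+ :- b2 ⊜ a2) refl a2 b2)
    rowOf-l (inj₁ (a1 , a2)) (inj₂ j) =
      pair≡ (solve 3 (λ a1 a2 j → a1 :+ a2 :+ j :+ :- j :+ (a1 :+ a2 :+ j :+ :- j) :+ :- (a1 :+ a2 :+ a2) ⊜ a1) refl a1 a2 j)
            (solve 3 (λ a1 a2 j → a1 :+ a2 :+ a2 :+ :- (a1 :+ a2 :+ j :+ :- j) ⊜ a2) refl a1 a2 j)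
    rowOf-l (inj₂ x) (inj₁ (b1 , b2)) with b2 ≟ ((b2 + x) - b1) + ((b1 + b2 - x) - b2)
    ... | yes _ = cong inj₂ (solve 2 (λ b2 x → b2 :+ x :+ :- b2 ⊜ x) refl b2 x)
    ... | no n = ⊥-elim (n (solve 3 (λ b1 b2 x → b2 ⊜ b2 :+ x :+ :- b1 :+ (b1 :+ b2 :+ :- x :+ :- b2)) refl b1 b2 x))
    rowOf-l (inj₂ x) (inj₂ j) = cong inj₂ (Cc-l x j)

    rowOf-r : ∀ c s → L (rowOf c s) c ≡ s
    rowOf-r (inj₁ (b1 , b2)) (inj₂ z) =
      trans (gridBlock-diag (b2 - b1 + z) (b1 - z) b1 b2 (solve 3 (λ b1 b2 z → b2 ⊜ b2 :+ :- b1 :+ z :+ (b1 :+ :- z)) refl b1 b2 z))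
            (cong inj₂ (solve 2 (λ b1 z → b1 :+ :- (b1 :+ :- z) ⊜ z) refl b1 z))
    rowOf-r (inj₁ (b1 , b2)) (inj₁ (d1 , d2)) with b2 ≟ (d1 - b1) + (d2 - b2)
    ... | yes e = pair≡ (solve 2 (λ b2 d1 → b2 :+ (d1 :+ :- b2) ⊜ d1) refl b2 d1)
                        (trans (cong (λ u → b1 + u - (d1 - b2)) e) (solve 4 (λ b1 b2 d1 d2 → b1 :+ (d1 :+ :- b1 :+ (d2 :+ :- b2)) :+ :- (d1 :+ :- b2) ⊜ d2) refl b1 b2 d1 d2))
    ... | no n = trans (gridBlock-off (d1 - b1) (d2 - b2) b1 b2 n)
                   (pair≡ (solve 2 (λ b1 d1 → d1 :+ :- b1 :+ b1 ⊜ d1) refl b1 d1) (solve 2 (λ b2 d2 → d2 :+ :- b2 :+ b2 ⊜ d2) refl b2 d2))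
    rowOf-r (inj₂ j) (inj₁ (d1 , d2)) =
      pair≡ (solve 3 (λ d1 d2 j → d1 :+ :- j :+ (d1 :+ :- j) :+ :- d2 :+ (d2 :+ :- (d1 :+ :- j)) :+ j ⊜ d1) refl d1 d2 j)
            (solve 3 (λ d1 d2 j → d1 :+ :- j :+ (d1 :+ :- j) :+ :- d2 :+ (d2 :+ :- (d1 :+ :- j)) :+ (d2 :+ :- (d1 :+ :- j)) ⊜ d2) refl d1 d2 j)
    rowOf-r (inj₂ j) (inj₂ z) = cong inj₂ (Cc-r j z)

    n : ℕ
    n = m ℕ.* m ℕ.+ m

    to : Fin n → I
    to i = [ (λ j → inj₁ (remQuot {m} m j)) , inj₂ ]′ (splitAt (m ℕ.* m) i)

    from : I → Fin n
    from (inj₁ (a , b)) = join (m ℕ.* m) m (inj₁ (combine a b))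
    from (inj₂ z) = join (m ℕ.* m) m (inj₂ z)

    to-from : ∀ x → to (from x) ≡ x
    to-from (inj₁ (a , b)) rewrite splitAt-join (m ℕ.* m) m (inj₁ (combine a b)) = cong inj₁ (remQuot-combine a b)
    to-from (inj₂ z) rewrite splitAt-join (m ℕ.* m) m (inj₂ {A = Fin (m ℕ.* m)} z) = refl

    from-to : ∀ i → from (to i) ≡ i
    from-to i with splitAt (m ℕ.* m) i in eq
    ... | inj₁ j = trans (cong (λ u → join (m ℕ.* m) m (inj₁ u)) (combine-remQuot {m} m j))
                         (trans (cong (join (m ℕ.* m) m) (sym eq)) (join-splitAt (m ℕ.* m) m i))
    ... | inj₂ z = trans (cong (join (m ℕ.* m) m) (sym eq)) (join-splitAt (m ℕ.* m) m i)

    allI : List I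
    allI = map to (allFin n)

    allI-u : Unique allI
    allI-u = UP.map⁺ (λ {i} {j} e → trans (sym (from-to i)) (trans (cong from e) (from-to j))) (UP.allFin⁺ n)

    allI-c : ∀ x → x ∈ allI
    allI-c x = subst (_∈ allI) (to-from x) (∈-map⁺ to (∈-allFin (from x)))

    allI-len : length allI ≡ n
    allI-len = trans (LP.length-map to (allFin n)) (LP.length-tabulate (λ i → i))

    colInj : ∀ r c c' → L r c ≡ L r c' → c ≡ c'
    colInj r c c' e = trans (sym (colOf-l r c)) (trans (cong (colOf r) e) (colOf-l r c'))
    rowInj : ∀ r r' c → L r c ≡ L r' c → r ≡ r'
    rowInj r r' c e = trans (sym (rowOf-l r c)) (trans (cong (rowOf c) e) (rowOf-l r' c))

    two three : Z
    two = 1# + 1#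
    three = two + 1#

    1≢0 : ¬ (1# ≡ 0#)
    1≢0 ()
    2≢0 : ¬ (two ≡ 0#)
    2≢0 ()

    ≟-true : ∀ {a b : Z} → a ≡ b → does (a ≟ b) ≡ true
    ≟-true {a} {b} = dec-true (a ≟ b)
    ≟-false : ∀ {a b : Z} → ¬ (a ≡ b) → does (a ≟ b) ≡ false
    ≟-false {a} {b} = dec-false (a ≟ b)
    ≟-true⁻ : ∀ {a b : Z} → does (a ≟ b) ≡ true → a ≡ b
    ≟-true⁻ {a} {b} e with a ≟ b
    ... | yes q = q
    ≟-true⁻ {a} {b} () | no _
    ≟-false⁻ : ∀ {a b : Z} → does (a ≟ b) ≡ false → ¬ (a ≡ b)
    ≟-false⁻ {a} {b} e q with a ≟ b
    ≟-false⁻ {a} {b} () q | yes _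
    ... | no n = n q

    true≢false : true ≡ false → ⊥
    true≢false ()

    shared : Ln I → Bool
    shared (rw (inj₁ (x1 , x2))) = does (x2 ≟ 0#)
    shared (rw (inj₂ _)) = false
    shared (cl (inj₁ (b1 , b2))) = does (b1 + b2 ≟ 0#)
    shared (cl (inj₂ _)) = false
    shared (sy (inj₁ (d1 , d2))) = does (d1 ≟ 0#)
    shared (sy (inj₂ _)) = false

    solo : Ln I → I × I
    solo (rw (inj₁ (a1 , a2))) = inj₁ (a1 , a2) , inj₁ (- a1 , a1)
    solo (rw (inj₂ x)) = inj₂ x , inj₁ (x , - x)
    solo (cl (inj₁ (b1 , b2))) = inj₁ (- b1 , 0#) , inj₁ (b1 , b2)
    solo (cl (inj₂ j)) = inj₁ (- j , 0#) , inj₂ j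
    solo (sy (inj₁ (d1 , d2))) = inj₁ (d1 + d2 , 0#) , inj₁ (- d2 , d2)
    solo (sy (inj₂ z)) = inj₁ (- z , 0#) , inj₁ (z , - z)

    tcol : I → I
    tcol (inj₁ (a1 , a2)) = inj₁ (a2 , a1 + a2 + 1#)
    tcol (inj₂ x) = inj₂ (π x)

    tsym-grid : ∀ a1 a2 → L (inj₁ (a1 , a2)) (tcol (inj₁ (a1 , a2))) ≡ inj₁ (a1 + a2 , a2 + (a1 + a2 + 1#))
    tsym-grid a1 a2 = gridBlock-off a1 a2 a2 (a1 + a2 + 1#) (λ e → 1≢0 (trans (solve 3 (λ a1 a2 o → o ⊜ a1 :+ a2 :+ o :+ :- (a1 :+ a2)) refl a1 a2 1#)
                                                          (trans (cong (_- (a1 + a2)) e) (solve 2 (λ a1 a2 → a1 :+ a2 :+ :- (a1 :+ a2) ⊜ :0) refl a1 a2))))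

    owner : Ln I → I
    owner (rw x) = x
    owner (cl (inj₁ (b1 , b2))) = inj₁ (b2 - b1 - 1# , b1)
    owner (cl (inj₂ j)) = inj₂ (πi j)
    owner (sy (inj₁ (d1 , d2))) = inj₁ (d1 + d1 - d2 + 1# , d2 - d1 - 1#)
    owner (sy (inj₂ z)) = inj₂ (κi z)

    open TransversalCovers

    _≟I_ : DecidableEquality I
    _≟I_ = ⊎-≡-dec (×-≡-dec _≟_ _≟_) _≟_

    module FrameHypotheses where
      open TransversalCovers.Frame _≟I_ L allI allI-u allI-c shared solo tcol owner public

      solo-on : ∀ ℓ → shared ℓ ≡ false → On (solo ℓ) ℓ
      solo-on (rw (inj₁ _)) _ = refl
      solo-on (rw (inj₂ _)) _ = refl
      solo-on (cl (inj₁ _)) _ = refl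
      solo-on (cl (inj₂ _)) _ = refl
      solo-on (sy (inj₁ (d1 , d2))) s = trans (gridBlock-off (d1 + d2) 0# (- d2) d2 off-diagonal)
          (pair≡ (solve 2 (λ d1 d2 → d1 :+ d2 :+ :- d2 ⊜ d1) refl d1 d2) (+-identityˡ d2))
        where
        off-diagonal : ¬ (d2 ≡ d1 + d2 + 0#)
        off-diagonal e = ≟-false⁻ s (trans (solve 2 (λ d1 d2 → d1 ⊜ d1 :+ d2 :+ :0 :+ :- d2) refl d1 d2)
                     (trans (cong (_- d2) (sym e)) (-‿inverseʳ d2)))
      solo-on (sy (inj₂ z)) _ = trans (gridBlock-diag (- z) 0# z (- z) (sym (+-identityʳ (- z))))
                                    (cong inj₂ (solve 1 (λ z → z :+ :- :0 ⊜ z) refl z))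

      solo-only : ∀ ℓ ℓ' → shared ℓ ≡ false → shared ℓ' ≡ false → On (solo ℓ) ℓ' → ℓ' ≡ ℓ
      solo-only (rw (inj₁ (a1 , a2))) (rw x) s s' refl = refl
      solo-only (rw (inj₁ (a1 , a2))) (cl x) s s' refl = ⊥-elim (≟-false⁻ s' (-‿inverseˡ a1))
      solo-only (rw (inj₁ (a1 , a2))) (sy x) s s' o = ⊥-elim (≟-false⁻ (subst (λ y → shared (sy y) ≡ false) (sym eq) s') (-‿inverseʳ a1))
        where
        off-diagonal : ¬ (a1 ≡ a1 + a2)
        off-diagonal e = ≟-false⁻ s (trans (solve 2 (λ a1 a2 → a2 ⊜ a1 :+ a2 :+ :- a1) refl a1 a2) (trans (cong (_- a1) (sym e)) (-‿inverseʳ a1)))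
        eq : inj₁ (a1 + - a1 , a2 + a1) ≡ x
        eq = trans (sym (gridBlock-off a1 a2 (- a1) a1 off-diagonal)) o
      solo-only (rw (inj₂ x0)) (rw x) s s' refl = refl
      solo-only (rw (inj₂ x0)) (cl x) s s' refl = ⊥-elim (≟-false⁻ s' (-‿inverseʳ x0))
      solo-only (rw (inj₂ x0)) (sy x) s s' refl = ⊥-elim (≟-false⁻ s' (-‿inverseˡ x0))
      solo-only (cl (inj₁ (b1 , b2))) (rw x) s s' refl = ⊥-elim (≟-false⁻ {0#} {0#} s' refl)
      solo-only (cl (inj₁ (b1 , b2))) (cl x) s s' refl = refl
      solo-only (cl (inj₁ (b1 , b2))) (sy x) s s' o = ⊥-elim (≟-false⁻ (subst (λ y → shared (sy y) ≡ false) (sym eq) s') (-‿inverseˡ b1))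
        where
        off-diagonal : ¬ (b2 ≡ - b1 + 0#)
        off-diagonal e = ≟-false⁻ s (trans (cong (b1 +_) e) (solve 1 (λ b1 → b1 :+ (:- b1 :+ :0) ⊜ :0) refl b1))
        eq : inj₁ (- b1 + b1 , 0# + b2) ≡ x
        eq = trans (sym (gridBlock-off (- b1) 0# b1 b2 off-diagonal)) o
      solo-only (cl (inj₂ j)) (rw x) s s' refl = ⊥-elim (≟-false⁻ {0#} {0#} s' refl)
      solo-only (cl (inj₂ j)) (cl x) s s' refl = refl
      solo-only (cl (inj₂ j)) (sy x) s s' refl = ⊥-elim (≟-false⁻ s' (solve 1 (λ j → :- j :+ :0 :+ j ⊜ :0) refl j))
      solo-only (sy (inj₁ (d1 , d2))) (rw x) s s' refl = ⊥-elim (≟-false⁻ {0#} {0#} s' refl)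
      solo-only (sy (inj₁ (d1 , d2))) (cl x) s s' refl = ⊥-elim (≟-false⁻ s' (-‿inverseˡ d2))
      solo-only (sy (inj₁ (d1 , d2))) (sy x) s s' o = cong sy (trans (sym o) (solo-on (sy (inj₁ (d1 , d2))) s))
      solo-only (sy (inj₂ z)) (rw x) s s' refl = ⊥-elim (≟-false⁻ {0#} {0#} s' refl)
      solo-only (sy (inj₂ z)) (cl x) s s' refl = ⊥-elim (≟-false⁻ s' (-‿inverseʳ z))
      solo-only (sy (inj₂ z)) (sy x) s s' o = cong sy (trans (sym o) (solo-on (sy (inj₂ z)) s))

      owner-on : ∀ ℓ → On (tcell (owner ℓ)) ℓ
      owner-on (rw x) = refl
      owner-on (cl (inj₁ (b1 , b2))) = pair≡ refl (solve 3 (λ b1 b2 o → b2 :+ :- b1 :+ :- o :+ b1 :+ o ⊜ b2) refl b1 b2 1#)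
      owner-on (cl (inj₂ j)) = cong inj₂ (π-r j)
      owner-on (sy (inj₁ (d1 , d2))) = trans (tsym-grid _ _) (pair≡
          (solve 3 (λ d1 d2 o → d1 :+ d1 :+ :- d2 :+ o :+ (d2 :+ :- d1 :+ :- o) ⊜ d1) refl d1 d2 1#)
          (solve 3 (λ d1 d2 o → d2 :+ :- d1 :+ :- o :+ (d1 :+ d1 :+ :- d2 :+ o :+ (d2 :+ :- d1 :+ :- o) :+ o) ⊜ d2) refl d1 d2 1#))
      owner-on (sy (inj₂ z)) = cong inj₂ (κ-r z)

      owner-unique : ∀ r ℓ → On (tcell r) ℓ → r ≡ owner ℓ
      owner-unique r (rw x) o = o
      owner-unique (inj₁ (a1 , a2)) (cl x) refl = pair≡ (solve 3 (λ a1 a2 o → a1 ⊜ a1 :+ a2 :+ o :+ :- a2 :+ :- o) refl a1 a2 1#) refl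
      owner-unique (inj₂ y) (cl x) refl = cong inj₂ (sym (π-l y))
      owner-unique (inj₁ (a1 , a2)) (sy x) o = trans (pair≡ (solve 3 (λ a1 a2 o → a1 ⊜ a1 :+ a2 :+ (a1 :+ a2) :+ :- (a2 :+ (a1 :+ a2 :+ o)) :+ o) refl a1 a2 1#)
                         (solve 3 (λ a1 a2 o → a2 ⊜ a2 :+ (a1 :+ a2 :+ o) :+ :- (a1 :+ a2) :+ :- o) refl a1 a2 1#))
                         (cong (λ y → owner (sy y)) (trans (sym (tsym-grid a1 a2)) o))
      owner-unique (inj₂ y) (sy x) refl = cong inj₂ (sym (κ-l y))

      unshared-line : ∀ r → Σ (Ln I) λ ℓ → shared ℓ ≡ false × On (tcell r) ℓ
      unshared-line (inj₂ y) = rw (inj₂ y) , refl , refl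
      unshared-line (inj₁ (a1 , a2)) with a2 ≟ 0#
      ... | no n = rw (inj₁ (a1 , a2)) , ≟-false n , refl
      ... | yes e2 with a2 + (a1 + a2 + 1#) ≟ 0#
      ... | no n = cl (inj₁ (a2 , a1 + a2 + 1#)) , ≟-false n , refl
      ... | yes e3 = sy (inj₁ (a1 + a2 , a2 + (a1 + a2 + 1#))) , ≟-false d1≢0 , tsym-grid a1 a2
        where
        d1≢0 : ¬ (a1 + a2 ≡ 0#)
        d1≢0 e4 = 1≢0 (begin
            1# ≡⟨ solve 3 (λ a1 a2 o → o ⊜ a2 :+ (a1 :+ a2 :+ o) :+ :- a2 :+ :- (a1 :+ a2)) refl a1 a2 1# ⟩
            a2 + (a1 + a2 + 1#) - a2 - (a1 + a2) ≡⟨ cong₂ (λ u v → u - a2 - v) e3 e4 ⟩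
            0# - a2 - 0# ≡⟨ cong (λ u → 0# - u - 0#) e2 ⟩
            0# - 0# - 0# ≡⟨ solve 0 (:0 :+ :- :0 :+ :- :0 ⊜ :0) refl ⟩
            0# ∎)
          where open ≡-Reasoning

      H : Hyp
      H = record { solo-on = solo-on ; solo-only = solo-only ; owner-on = owner-on ; owner-unique = owner-unique ; unshared-line = unshared-line }

    module Covers where
      open FrameHypotheses
      open WithHyp H

      SR SC SS : List I
      SR = map (λ z → inj₁ (z , 0#)) (allFin m)
      SC = map (λ z → inj₁ (z , - z)) (allFin m)
      SS = map (λ z → inj₁ (0# , z)) (allFin m)

      inj₁-pair : ∀ {a b c d : Z} → _≡_ {A = I} (inj₁ (a , b)) (inj₁ (c , d)) → (a ≡ c) × (b ≡ d)
      inj₁-pair refl = refl , refl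

      uR : Unique SR
      uR = UP.map⁺ (λ e → proj₁ (inj₁-pair e)) (UP.allFin⁺ m)
      uC : Unique SC
      uC = UP.map⁺ (λ e → proj₁ (inj₁-pair e)) (UP.allFin⁺ m)
      uS : Unique SS
      uS = UP.map⁺ (λ e → proj₂ (inj₁-pair e)) (UP.allFin⁺ m)

      lenF : ∀ (f : Z → I) → length (map f (allFin m)) ≡ m
      lenF f = trans (LP.length-map f (allFin m)) (LP.length-tabulate (λ i → i))

      hR : ∀ x → shared (rw x) ≡ true → x ∈ SR
      hR (inj₁ (x1 , x2)) e = subst (λ u → inj₁ (x1 , u) ∈ SR) (sym (≟-true⁻ e)) (∈-map⁺ (λ z → inj₁ (z , 0#)) (∈-allFin x1))
      hR (inj₂ _) ()
      hR' : ∀ x → x ∈ SR → shared (rw x) ≡ true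
      hR' x mm with ∈-map⁻ (λ z → inj₁ (z , 0#)) mm
      ... | z , _ , refl = ≟-true {0#} {0#} refl
      hC : ∀ x → shared (cl x) ≡ true → x ∈ SC
      hC (inj₁ (b1 , b2)) e = subst (λ u → inj₁ (b1 , u) ∈ SC) (sym (inverseʳ-unique b1 b2 (≟-true⁻ e))) (∈-map⁺ (λ z → inj₁ (z , - z)) (∈-allFin b1))
      hC (inj₂ _) ()
      hC' : ∀ x → x ∈ SC → shared (cl x) ≡ true
      hC' x mm with ∈-map⁻ (λ z → inj₁ (z , - z)) mm
      ... | z , _ , refl = ≟-true (-‿inverseʳ z)
      hS : ∀ x → shared (sy x) ≡ true → x ∈ SS
      hS (inj₁ (d1 , d2)) e = subst (λ u → inj₁ (u , d2) ∈ SS) (sym (≟-true⁻ e)) (∈-map⁺ (λ z → inj₁ (0# , z)) (∈-allFin d2))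
      hS (inj₂ _) ()
      hS' : ∀ x → x ∈ SS → shared (sy x) ≡ true
      hS' x mm with ∈-map⁻ (λ z → inj₁ (0# , z)) mm
      ... | z , _ , refl = ≟-true {0#} {0#} refl

      open Counting SR SC SS uR uC uS hR hR' hC hC' hS hS' public using (P2; P3; counting)

      m2 m3 : ℕ
      m2 = length P2
      m3 = length P3

      double-count : n ℕ.+ m2 ℕ.+ 2 ℕ.* m3 ℕ.+ (m ℕ.+ m ℕ.+ m) ≡ 3 ℕ.* n
      double-count = subst (λ N → N ℕ.+ m2 ℕ.+ 2 ℕ.* m3 ℕ.+ (m ℕ.+ m ℕ.+ m) ≡ 3 ℕ.* N) allI-len
                 (subst (λ X → length allI ℕ.+ m2 ℕ.+ 2 ℕ.* m3 ℕ.+ X ≡ 3 ℕ.* length allI)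
                   (cong₂ ℕ._+_ (cong₂ ℕ._+_ (lenF _) (lenF _)) (lenF _)) counting)

      -- Every shared line passes through the solo entry of an unshared line of
      -- the corner, whose owner (a corner row) has degree 3.
      partner : Ln I → Ln I
      partner (rw (inj₁ (x1 , _))) = sy (inj₂ (- x1))
      partner (cl (inj₁ (b1 , _))) = rw (inj₂ b1)
      partner (sy (inj₁ (_ , d2))) = cl (inj₂ (- d2))
      partner _ = rw (inj₂ 0#)

      partner-facts : ∀ ℓ → shared ℓ ≡ true → (shared (partner ℓ) ≡ false) × On (solo (partner ℓ)) ℓ × Σ Z (λ y → owner (partner ℓ) ≡ inj₂ y)
      partner-facts (rw (inj₁ (x1 , x2))) s = refl , pair≡ (⁻¹-involutive x1) (sym (≟-true⁻ s)) , _ , refl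
      partner-facts (rw (inj₂ _)) ()
      partner-facts (cl (inj₁ (b1 , b2))) s = refl , pair≡ refl (sym (inverseʳ-unique b1 b2 (≟-true⁻ s))) , _ , refl
      partner-facts (cl (inj₂ _)) ()
      partner-facts (sy (inj₁ (d1 , d2))) s = refl , pair≡ (trans (solve 1 (λ j → :- j :+ :0 :+ j ⊜ :0) refl (- d2)) (sym (≟-true⁻ s)))
                                                    (solve 1 (λ d2 → :- (:- d2) :+ :0 :+ :0 ⊜ d2) refl d2) , _ , refl
      partner-facts (sy (inj₂ _)) ()

      degree-owner-partner : ∀ ℓ → shared ℓ ≡ true → degree (owner (partner ℓ)) ≡ 3
      degree-owner-partner ℓ s with partner-facts ℓ s
      ... | _ , _ , y , e = subst (λ r → degree r ≡ 3) (sym e) refl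

      -- fRow has degree 2, its only shared line being its column, whose partner
      -- is owned by the corner row gRow; replacing both adds 1 + 2 entries.
      fRow gRow : I
      fRow = inj₁ (- three , 1#)
      gRow = inj₂ 1#

      degree≡ : ∀ r {a b c} → shared (rw r) ≡ a → shared (cl (tcol r)) ≡ b → shared (sy (tsym r)) ≡ c →
           degree r ≡ ind (not a) ℕ.+ ind (not b) ℕ.+ ind (not c)
      degree≡ r ea eb ec rewrite ea | eb | ec = refl

      fRow-col-shared : shared (cl (tcol fRow)) ≡ true
      fRow-col-shared = ≟-true (solve 1 (λ o → o :+ (:- (o :+ o :+ o) :+ o :+ o) ⊜ :0) refl 1#)

      fRow-sym-nsh : ¬ (- three + 1# ≡ 0#)
      fRow-sym-nsh e = 2≢0 (trans (solve 1 (λ o → o :+ o ⊜ :- (:- (o :+ o :+ o) :+ o)) refl 1#)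
                                (trans (cong -_ e) (solve 0 (:- :0 ⊜ :0) refl)))

      fRow-sym-shared : shared (sy (tsym fRow)) ≡ false
      fRow-sym-shared = trans (cong (λ y → shared (sy y)) (tsym-grid (- three) 1#)) (≟-false fRow-sym-nsh)

      degree-fRow : degree fRow ≡ 2
      degree-fRow = degree≡ fRow {false} {true} {false} refl fRow-col-shared fRow-sym-shared

      fRow-D : ∀ ℓ → shared ℓ ≡ true → owner ℓ ≡ fRow → owner (partner ℓ) ≡ gRow
      fRow-D ℓ s e = go ℓ s (subst (λ r → On (tcell r) ℓ) e (owner-on ℓ))
        where
        go : ∀ ℓ → shared ℓ ≡ true → On (tcell fRow) ℓ → owner (partner ℓ) ≡ gRow
        go (rw x) s refl with s
        ... | ()
        go (cl x) s refl = refl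
        go (sy x) s o = ⊥-elim (true≢false (trans (sym s) (trans (cong (λ y → shared (sy y)) (sym o)) fRow-sym-shared)))

      r1 r2 c' r'' : I
      r1 = inj₁ (0# , - 1#)
      r2 = inj₁ (- two , 0#)
      c' = inj₁ (1# , - 1#)
      r'' = inj₁ (- 1# , - 1#)

      neg1≢0 : ¬ (- 1# ≡ 0#)
      neg1≢0 e = 1≢0 (trans (sym (⁻¹-involutive 1#)) (trans (cong -_ e) (solve 0 (:- :0 ⊜ :0) refl)))

      r12 : ¬ (r1 ≡ r2)
      r12 e = neg1≢0 (proj₂ (inj₁-pair e))

      ec' : L r2 c' ≡ tsym r1
      ec' = trans (gridBlock-off (- two) 0# 1# (- 1#) n1)
                  (trans (pair≡ (solve 1 (λ o → :- (o :+ o) :+ o ⊜ :0 :+ :- o) refl 1#)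
                                (solve 1 (λ o → :0 :+ :- o ⊜ :- o :+ (:0 :+ :- o :+ o)) refl 1#))
                         (sym (tsym-grid 0# (- 1#))))
        where
        n1 : ¬ (- 1# ≡ - two + 0#)
        n1 e = 1≢0 (trans (solve 1 (λ o → o ⊜ :- (:- (o :+ o) :+ :0 :+ :- (:- o))) refl 1#)
                     (trans (cong (λ u → - (u - (- 1#))) (sym e)) (solve 1 (λ o → :- (:- o :+ :- (:- o)) ⊜ :0) refl 1#)))

      er'' : L r'' (tcol r1) ≡ tsym r2
      er'' = trans (gridBlock-off (- 1#) (- 1#) (- 1#) (0# + - 1# + 1#) n2)
                   (trans (pair≡ (solve 1 (λ o → :- o :+ :- o ⊜ :- (o :+ o) :+ :0) refl 1#)
                                 (solve 1 (λ o → :- o :+ (:0 :+ :- o :+ o) ⊜ :0 :+ (:- (o :+ o) :+ :0 :+ o)) refl 1#))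
                          (sym (tsym-grid (- two) 0#)))
        where
        n2 : ¬ (0# + - 1# + 1# ≡ - 1# + - 1#)
        n2 e = 2≢0 (trans (solve 1 (λ o → o :+ o ⊜ :- (:- o :+ :- o) :+ :0) refl 1#)
                     (trans (cong (λ u → - (- 1# + - 1#) + u) (solve 1 (λ o → :0 ⊜ :0 :+ :- o :+ o) refl 1#))
                     (trans (cong (λ u → - (- 1# + - 1#) + u) e) (-‿inverseˡ (- 1# + - 1#)))))

      inj₂≢inj₁ : ∀ {y : Z} {x : G} → _≡_ {A = I} (inj₂ y) (inj₁ x) → ⊥
      inj₂≢inj₁ ()

      H-special : ¬ (owner (sy (L r1 (tcol r2))) ≡ owner (cl c'))
      H-special e = inj₂≢inj₁ (trans (cong (λ y → owner (sy y)) (sym (gridBlock-diag 0# (- 1#) 0# (- two + 0# + 1#)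
                             (solve 1 (λ o → :- (o :+ o) :+ :0 :+ o ⊜ :0 :+ :- o) refl 1#)))) e)

      open Special colInj rowInj r1 r2 c' r'' r12 ec' er'' H-special using () renaming (C to C₁; goodC to certified-C₁; lenC to length-C₁)


      uP2 : Unique P2
      uP2 = UP.filter⁺ (λ r → degree r ℕP.≟ 2) allI-u
      uP3 : Unique P3
      uP3 = UP.filter⁺ (λ r → degree r ℕP.≟ 3) allI-u
      pP2 : ∀ r → r ∈ P2 → degree r ≡ 2
      pP2 r mm = proj₂ (∈-filter⁻ (λ r → degree r ℕP.≟ 2) {xs = allI} mm)
      pP3 : ∀ r → r ∈ P3 → degree r ≡ 3
      pP3 r mm = proj₂ (∈-filter⁻ (λ r → degree r ℕP.≟ 3) {xs = allI} mm)
      inP3 : ∀ r → degree r ≡ 3 → r ∈ P3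
      inP3 r e = ∈-filter⁺ (λ r → degree r ℕP.≟ 3) (allI-c r) e

      open Indicators _≟I_ using (without; length-without-∈)
      Q3 : List I
      Q3 = without gRow P3
      uQ3 : Unique Q3
      uQ3 = UP.filter⁺ (λ y → ¬? (y ≟I gRow)) uP3
      Q3-mem : ∀ {r} → r ∈ Q3 → r ∈ P3 × ¬ (r ≡ gRow)
      Q3-mem mm = ∈-filter⁻ (λ y → ¬? (y ≟I gRow)) {xs = P3} mm
      Q3-len : suc (length Q3) ≡ m3
      Q3-len = length-without-∈ gRow P3 uP3 (inP3 gRow refl)

      CertifiedOfSize : ℕ → Set
      CertifiedOfSize c = Σ (List Cell) λ C → Certified C × length C ≡ c

      evens : ∀ q → q ℕ.≤ m3 → CertifiedOfSize (n ℕ.+ (q ℕ.+ q))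
      evens q le = Evens.cov , Evens.certified-replace (λ ℓ s ()) ,
        trans (trans Evens.length-replace (cong₂ (λ a b → a ℕ.+ 0 ℕ.+ 2 ℕ.* b) allI-len (length-take-≤ q P3 le))) (evens-size n q)
        where
        module Evens = Replacing [] (take q P3) [] (UP.take⁺ q uP3) (λ _ ()) (λ r mm → pP3 r (take-⊆ q P3 mm))
        evens-size : ∀ n q → n ℕ.+ 0 ℕ.+ 2 ℕ.* q ≡ n ℕ.+ (q ℕ.+ q)
        evens-size n q = cong₂ ℕ._+_ (ℕP.+-identityʳ n) (cong (q ℕ.+_) (ℕP.+-identityʳ q))

      odds : ∀ q' → suc q' ℕ.≤ m3 → CertifiedOfSize (n ℕ.+ suc (suc q' ℕ.+ suc q'))
      odds q' le = Odds.cov , Odds.certified-replace partner-in-Kl , trans Odds.length-replace (trans (cong₂ (λ a b → a ℕ.+ 1 ℕ.+ 2 ℕ.* suc b) allI-len lt) (odds-size n q'))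
        where
        le' : q' ℕ.≤ length Q3
        le' = ℕ.s≤s⁻¹ (subst (suc q' ℕ.≤_) (sym Q3-len) le)
        lt : length (take q' Q3) ≡ q'
        lt = length-take-≤ q' Q3 le'
        Kl : List I
        Kl = gRow ∷ take q' Q3
        uK : Unique Kl
        uK = All.tabulate (λ mm e → proj₂ (Q3-mem (take-⊆ q' Q3 mm)) (sym e)) ∷ UP.take⁺ q' uQ3
        pK : ∀ r → r ∈ Kl → degree r ≡ 3
        pK r (here refl) = refl
        pK r (there mm) = pP3 r (proj₁ (Q3-mem (take-⊆ q' Q3 mm)))
        pF : ∀ r → r ∈ (fRow ∷ []) → degree r ≡ 2
        pF r (here refl) = degree-fRow
        module Odds = Replacing (fRow ∷ []) Kl ([] ∷ []) uK pF pK
        partner-in-Kl : ∀ ℓ → shared ℓ ≡ true → owner ℓ ∈ (fRow ∷ []) → Σ (Ln I) λ ℓ' → shared ℓ' ≡ false × On (solo ℓ') ℓ × owner ℓ' ∈ Kl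
        partner-in-Kl ℓ s (here e) = partner ℓ , proj₁ (partner-facts ℓ s) , proj₁ (proj₂ (partner-facts ℓ s)) , here (fRow-D ℓ s e)
        odds-size : ∀ n q' → n ℕ.+ 1 ℕ.+ 2 ℕ.* suc q' ≡ n ℕ.+ suc (suc q' ℕ.+ suc q')
        odds-size = solve-∀

      tail : ∀ j → j ℕ.≤ m2 → CertifiedOfSize (n ℕ.+ (j ℕ.+ 2 ℕ.* m3))
      tail j le = Tail.cov , Tail.certified-replace partner-in-Kl , trans Tail.length-replace (trans (cong₂ (λ a b → a ℕ.+ b ℕ.+ 2 ℕ.* m3) allI-len (length-take-≤ j P2 le)) (ℕP.+-assoc n j _))
        where
        module Tail = Replacing (take j P2) P3 (UP.take⁺ j uP2) uP3 (λ r mm → pP2 r (take-⊆ j P2 mm)) pP3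
        partner-in-Kl : ∀ ℓ → shared ℓ ≡ true → owner ℓ ∈ take j P2 → Σ (Ln I) λ ℓ' → shared ℓ' ≡ false × On (solo ℓ') ℓ × owner ℓ' ∈ P3
        partner-in-Kl ℓ s _ = partner ℓ , proj₁ (partner-facts ℓ s) , proj₁ (proj₂ (partner-facts ℓ s)) , inP3 _ (degree-owner-partner ℓ s)

      one : CertifiedOfSize (n ℕ.+ 1)
      one = C₁ , certified-C₁ , trans length-C₁ (trans (cong suc allI-len) (ℕP.+-comm 1 n))

      -- hence the largest cover, replacing every row of degree 2 or 3, has 3m² entries
      total : n ℕ.+ (m2 ℕ.+ 2 ℕ.* m3) ≡ 3 ℕ.* (m ℕ.* m)
      total = ℕP.+-cancelʳ-≡ (m ℕ.+ m ℕ.+ m) _ _ (trans (cong (ℕ._+ (m ℕ.+ m ℕ.+ m)) (sym (ℕP.+-assoc n m2 (2 ℕ.* m3))))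
                                            (trans double-count (three-n m)))
        where
        three-n : ∀ m → 3 ℕ.* (m ℕ.* m ℕ.+ m) ≡ 3 ℕ.* (m ℕ.* m) ℕ.+ (m ℕ.+ m ℕ.+ m)
        three-n = solve-∀

      module T = Transport.Tr n to from to-from from-to L colOf rowOf colOf-l colOf-r rowOf-l rowOf-r

      LS : LatinSquare n
      LS = T.LS

      open SizeRange.Sizes n m2 m3 CertifiedOfSize evens odds tail one using (every-size)

      size-bound : ∀ c → c ℕ.≤ 3 ℕ.* (m ℕ.* m) → c ℕ.∸ n ℕ.≤ m2 ℕ.+ 2 ℕ.* m3
      size-bound c c3 = subst (c ℕ.∸ n ℕ.≤_) (trans (cong (ℕ._∸ n) (sym total)) (ℕP.m+n∸m≡n n (m2 ℕ.+ 2 ℕ.* m3))) (ℕP.∸-monoˡ-≤ n c3)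

      all-sizes : ∀ c → n ℕ.≤ c → c ℕ.≤ 3 ℕ.* (m ℕ.* m) → HasMinimalCover LS c
      all-sizes c n≤c c≤3m² =
        subst (HasMinimalCover LS) (trans (proj₂ (proj₂ witness)) (ℕP.m+[n∸m]≡n n≤c))
              (T.minimal-cover (proj₁ witness) (proj₁ (proj₂ witness)))
        where
        witness : CertifiedOfSize (n ℕ.+ (c ℕ.∸ n))
        witness = every-size (c ℕ.∸ n) (size-bound c c≤3m²)


module OrderSix where

  open import Defs
  open import Data.Nat using (ℕ; suc; _≤_; s≤s)
  open import Data.Fin using (Fin; #_)
  open import Data.Fin.Properties using (_≟_; all?; any?)
  open import Data.Product using (_×_; _,_; proj₁; proj₂; ∃-syntax)
  open import Data.Product.Properties using (≡-dec)
  open import Data.Vec using (Vec; []; _∷_; lookup)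
  open import Data.List using (List; []; _∷_; length)
  open import Data.List.Relation.Unary.Any using (Any)
  import Data.List.Relation.Unary.Any as Any
  import Data.List.Relation.Unary.Unique.DecPropositional as UDec
  open import Data.List.Membership.DecPropositional (≡-dec (_≟_ {6}) (_≟_ {6})) using (_∈?_)
  open import Data.List.Membership.Propositional using (_∈_)
  open import Relation.Nullary
  open import Relation.Nullary.Decidable using (toWitness; _×-dec_; _→-dec_; map′; ¬?)
  open import Relation.Binary.PropositionalEquality hiding (sym)
  open import Data.Unit using (tt)

  row6 : Vec (Vec (Fin 6) 6) 6
  row6 = (# 4 ∷ # 1 ∷ # 5 ∷ # 3 ∷ # 0 ∷ # 2 ∷ []) ∷
         (# 1 ∷ # 5 ∷ # 3 ∷ # 4 ∷ # 2 ∷ # 0 ∷ []) ∷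
         (# 2 ∷ # 4 ∷ # 0 ∷ # 5 ∷ # 3 ∷ # 1 ∷ []) ∷
         (# 5 ∷ # 2 ∷ # 4 ∷ # 0 ∷ # 1 ∷ # 3 ∷ []) ∷
         (# 0 ∷ # 3 ∷ # 1 ∷ # 2 ∷ # 5 ∷ # 4 ∷ []) ∷
         (# 3 ∷ # 0 ∷ # 2 ∷ # 1 ∷ # 4 ∷ # 5 ∷ []) ∷ []

  L6 : Fin 6 → Fin 6 → Fin 6
  L6 i j = lookup (lookup row6 i) j

  rowDec : Dec (∀ i s → ∃[ j ] (L6 i j ≡ s × (∀ j' → L6 i j' ≡ s → j' ≡ j)))
  rowDec = all? λ i → all? λ s → any? λ j → (L6 i j ≟ s) ×-dec all? (λ j' → (L6 i j' ≟ s) →-dec (j' ≟ j))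

  colDec : Dec (∀ j s → ∃[ i ] (L6 i j ≡ s × (∀ i' → L6 i' j ≡ s → i' ≡ i)))
  colDec = all? λ j → all? λ s → any? λ i → (L6 i j ≟ s) ×-dec all? (λ i' → (L6 i' j ≟ s) →-dec (i' ≟ i))

  S6 : LatinSquare 6
  S6 = record { L = L6 ; rowOnce = toWitness {a? = rowDec} tt ; colOnce = toWitness {a? = colDec} tt }

  onDec : ∀ (e : Cell 6) ℓ → Dec (OnLine S6 e ℓ)
  onDec (i , j) (row r) = i ≟ r
  onDec (i , j) (col c) = j ≟ c
  onDec (i , j) (sym s) = L6 i j ≟ s

  coverDec : ∀ C → Dec (IsCover S6 C)
  coverDec C = map′ (λ { (a , b , c) (row r) → a r ; (a , b , c) (col x) → b x ; (a , b , c) (sym s) → c s })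
                    (λ f → (λ r → f (row r)) , (λ x → f (col x)) , (λ s → f (sym s)))
                    (all? (λ r → Any.any? (λ e → onDec e (row r)) C) ×-dec
                     (all? (λ x → Any.any? (λ e → onDec e (col x)) C) ×-dec
                      all? (λ s → Any.any? (λ e → onDec e (sym s)) C)))

  minDec : ∀ C → Dec (IsMinimalCover S6 C)
  minDec C = UDec.unique? (≡-dec (_≟_ {6}) (_≟_ {6})) C ×-dec (coverDec C ×-dec
    map′ (λ f e → f (proj₁ e) (proj₂ e)) (λ f i j → f (i , j))
      (all? λ i → all? λ j → ((i , j) ∈? C) →-dec ¬? (coverDec (C without (i , j)))))

  mk : ∀ (C : List (Cell 6)) → {True : Relation.Nullary.Decidable.True (minDec C)} → HasMinimalCover S6 (length C)
  mk C {w} = C , toWitness {a? = minDec C} w , refl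

  c6 : HasMinimalCover S6 6
  c6 = mk ((# 0 , # 0) ∷ (# 1 , # 4) ∷ (# 2 , # 3) ∷ (# 3 , # 5) ∷ (# 4 , # 2) ∷ (# 5 , # 1) ∷ [])

  c7 : HasMinimalCover S6 7
  c7 = mk ((# 0 , # 4) ∷ (# 1 , # 1) ∷ (# 1 , # 3) ∷ (# 2 , # 0) ∷ (# 3 , # 5) ∷ (# 4 , # 2) ∷ (# 5 , # 1) ∷ [])

  c8 : HasMinimalCover S6 8
  c8 = mk ((# 0 , # 2) ∷ (# 0 , # 5) ∷ (# 1 , # 5) ∷ (# 2 , # 1) ∷ (# 2 , # 4) ∷ (# 3 , # 3) ∷ (# 4 , # 0) ∷ (# 5 , # 3) ∷ [])

  c9 : HasMinimalCover S6 9
  c9 = mk ((# 0 , # 1) ∷ (# 0 , # 2) ∷ (# 1 , # 4) ∷ (# 1 , # 5) ∷ (# 2 , # 3) ∷ (# 2 , # 4) ∷ (# 3 , # 0) ∷ (# 4 , # 5) ∷ (# 5 , # 5) ∷ [])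

  c10 : HasMinimalCover S6 10
  c10 = mk ((# 0 , # 3) ∷ (# 0 , # 5) ∷ (# 1 , # 0) ∷ (# 1 , # 1) ∷ (# 1 , # 2) ∷ (# 1 , # 5) ∷ (# 2 , # 5) ∷ (# 3 , # 4) ∷ (# 4 , # 5) ∷ (# 5 , # 5) ∷ [])

  c11 : HasMinimalCover S6 11
  c11 = mk ((# 0 , # 0) ∷ (# 0 , # 3) ∷ (# 1 , # 0) ∷ (# 1 , # 2) ∷ (# 1 , # 4) ∷ (# 2 , # 4) ∷ (# 3 , # 5) ∷ (# 4 , # 0) ∷ (# 4 , # 1) ∷ (# 4 , # 4) ∷ (# 5 , # 0) ∷ [])

  c12 : HasMinimalCover S6 12
  c12 = mk ((# 0 , # 0) ∷ (# 0 , # 1) ∷ (# 0 , # 3) ∷ (# 0 , # 4) ∷ (# 1 , # 0) ∷ (# 2 , # 0) ∷ (# 2 , # 2) ∷ (# 2 , # 3) ∷ (# 2 , # 5) ∷ (# 3 , # 3) ∷ (# 4 , # 0) ∷ (# 5 , # 3) ∷ [])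


  all-sizes : ∀ c → 6 ≤ c → c ≤ 12 → HasMinimalCover S6 c
  all-sizes 0 () _
  all-sizes 1 (s≤s ()) _
  all-sizes 2 (s≤s (s≤s ())) _
  all-sizes 3 (s≤s (s≤s (s≤s ()))) _
  all-sizes 4 (s≤s (s≤s (s≤s (s≤s ())))) _
  all-sizes 5 (s≤s (s≤s (s≤s (s≤s (s≤s ()))))) _
  all-sizes 6 _ _ = c6
  all-sizes 7 _ _ = c7
  all-sizes 8 _ _ = c8
  all-sizes 9 _ _ = c9
  all-sizes 10 _ _ = c10
  all-sizes 11 _ _ = c11
  all-sizes 12 _ _ = c12
  all-sizes (suc (suc (suc (suc (suc (suc (suc (suc (suc (suc (suc (suc (suc _))))))))))))) _
     (s≤s (s≤s (s≤s (s≤s (s≤s (s≤s (s≤s (s≤s (s≤s (s≤s (s≤s (s≤s ()))))))))))))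



open import Defs
open import Data.Nat using (ℕ; suc; _+_; _*_; _≤_; s≤s)
open import Data.Product using (Σ; _,_)

theorem3p5 : ∀ (t : ℕ) → 2 ≤ t →
    Σ (LatinSquare (t * t + t)) λ S →
    ∀ (c : ℕ) → t * t + t ≤ c → c ≤ 3 * (t * t) → HasMinimalCover S c
theorem3p5 0 ()
theorem3p5 1 (s≤s ())
theorem3p5 2 _ = OrderSix.S6 , OrderSix.all-sizes
theorem3p5 (suc (suc (suc k))) _ = M.LS , M.all-sizes
  where module M = Construction.Order.Covers k (CornerSquares.cornerFor k)
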